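{- Let $k$ be a positive integer and $a,b$ integers with $1\le a<b\le k$. Then: (i) for $m\ge1$, $g_{a,b,k}(m,a)=\mu^mq^{ma}$; (ii) for $m\ge1$ and $h\ge1$, \[ g_{a,b,k}(m,kh+a)=\sum_{i\geq 0}\mu^{m-h-i}\nu^{h+i}q^{ma+kh^2+(b-a)(h+i)}{{h+i-1}\brack{h-1}}_k{{m-h-i}\brack{h}}_k; \] (iii) for $m\ge1$ and $h\ge0$, \[ g_{a,b,k}(m,kh+b)=\sum_{i\geq 0}\mu^{m-h-i-1}\nu^{h+i+1}q^{ma+kh^2+kh+(b-a)(h+i+1)}{{h+i}\brack{h}}_k{{m-h-i-1}\brack{h}}_k. \]
   Context: For $m\ge1$, $\mathcal{B}_{a,b,k}(m)$ is the set of partitions $\lambda=(\lambda_1\ge\cdots\ge\lambda_m)$ with $m$ parts, all congruent to $a$ or $b$ modulo $k$, such that $\lambda_m\in\{a,b\}$ and $\lambda_i<\lambda_{i+1}+k$ for $1\le i<m$. For a positive integer $l$, $g_{a,b,k}(m,l)=\sum \mu^{\ell_a(\lambda)}\nu^{\ell_b(\lambda)}q^{|\lambda|}$, summed over $\lambda\in\mathcal{B}_{a,b,k}(m)$ with largest part $\lambda_1=l$, where $\ell_a(\lambda)$ (resp. $\ell_b(\lambda)$) is the number of parts congruent to $a$ (resp. $b$) modulo $k$ and $|\lambda|$ is the sum of parts. ${A\brack B}_k=\frac{(q^k;q^k)_A}{(q^k;q^k)_B(q^k;q^k)_{A-B}}$ if $A\ge B\ge0$ and $0$ otherwise (including when an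 entry is negative), with $(x;q)_n=\prod_{i=0}^{n-1}(1-xq^i)$. -}

module Defs where

open import Data.Bool using (Bool; true; false; _∧_; _∨_; if_then_else_)
open import Data.Nat as ℕ using (ℕ; zero; suc; NonZero; _%_)
import Data.Nat.Properties as ℕP
open import Data.Integer as ℤ using (ℤ; +_; -[1+_])
open import Data.List using (List; []; _∷_; map; concatMap; filter; length; foldr)
open import Data.Rational as ℚ using (ℚ; 0ℚ; 1ℚ; _*_; _+_; _-_; _÷_; ≢-nonZero)
open import Data.Rational.Properties using (_≟_)
open import Relation.Nullary using (yes; no; does)

infixr 8 _^_
_^_ : ℚ → ℕ → ℚ
x ^ zero  = 1ℚ
x ^ suc n = x * (x ^ n)

sumℚ : ℕ → (ℕ → ℚ) → ℚ
sumℚ zero    f = 0ℚ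
sumℚ (suc n) f = sumℚ n f + f n

qPoch : ℚ → ℚ → ℕ → ℚ
qPoch x q zero    = 1ℚ
qPoch x q (suc n) = qPoch x q n * (1ℚ - x * (q ^ n))

qkPoch : ℚ → ℕ → ℕ → ℚ
qkPoch q k n = qPoch (q ^ k) (q ^ k) n

-- The ratio A / D (defined as 0 in the degenerate case D = 0, which never
-- occurs under the hypotheses q ≠ ±1 of the statement).
safeDiv : ℚ → ℚ → ℚ
safeDiv A D with D ≟ 0ℚ
... | yes _  = 0ℚ
... | no D≢0 = _÷_ A D {{≢-nonZero D≢0}}

qbinNat : ℚ → ℕ → ℕ → ℕ → ℚ
qbinNat q k A B with B ℕ.≤? A
... | yes _ = safeDiv (qkPoch q k A) (qkPoch q k B * qkPoch q k (A ℕ.∸ B))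
... | no _  = 0ℚ

qbin : ℚ → ℕ → ℤ → ℤ → ℚ
qbin q k (+ A)    (+ B)    = qbinNat q k A B
qbin q k (+ A)    -[1+ _ ] = 0ℚ
qbin q k -[1+ _ ] _        = 0ℚ

-- Partitions in B_{a,b,k}(m), represented as lists (λ₁, ..., λ_m).

allLists : ℕ → ℕ → List (List ℕ)
allLists zero    l = [] ∷ []
allLists (suc m) l = concatMap (λ xs → map (_∷ xs) (range (suc l))) (allLists m l)
  where
  range : ℕ → List ℕ
  range zero    = []
  range (suc n) = n ∷ range n

module _ (k a b : ℕ) .{{_ : NonZero k}} where

  congB : ℕ → ℕ → Bool
  congB n c = does ((n % k) ℕ.≟ (c % k))

  partsOK : List ℕ → Bool
  partsOK []       = true
  partsOK (x ∷ xs) = (congB x a ∨ congB x b) ∧ partsOK xs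

  chainOK : List ℕ → Bool
  chainOK []           = false
  chainOK (x ∷ [])     = does (x ℕ.≟ a) ∨ does (x ℕ.≟ b)
  chainOK (x ∷ y ∷ xs) =
    does (y ℕ.≤? x) ∧ does (x ℕ.<? y ℕ.+ k) ∧ chainOK (y ∷ xs)

  headIs : ℕ → List ℕ → Bool
  headIs l []      = false
  headIs l (x ∷ _) = does (x ℕ.≟ l)

  inB : ℕ → List ℕ → Bool
  inB l λs = partsOK λs ∧ chainOK λs ∧ headIs l λs

  countCong : ℕ → List ℕ → ℕ
  countCong c []       = 0
  countCong c (x ∷ xs) = (if congB x c then 1 else 0) ℕ.+ countCong c xs

  size : List ℕ → ℕ
  size = foldr ℕ._+_ 0

  weight : ℚ → ℚ → ℚ → List ℕ → ℚ
  weight μ ν q λs = (μ ^ countCong a λs) * (ν ^ countCong b λs) * (q ^ size λs)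

  -- g_{a,b,k}(m,l) = Σ_{λ ∈ B_{a,b,k}(m), λ₁ = l} μ^{ℓ_a(λ)} ν^{ℓ_b(λ)} q^{|λ|}
  -- (the partitions are enumerated among all length-m lists with entries ≤ l,
  --  which contains every such λ since λ₁ = l is the largest part)
  g : ℚ → ℚ → ℚ → ℕ → ℕ → ℚ
  g μ ν q m l = foldr _+_ 0ℚ
    (map (weight μ ν q) (filter (λ λs → inB l λs Data.Bool.≟ true) (allLists m l)))

module Submission where

-- For a bound L, let G(m, l) be the weighted sum over the lists of length m with entries ≤ L that lie
-- in B_{a,b,k}(m) and have largest part l.  Removing the largest part l leaves a partition whose
-- largest part lies in the window (l − k, l]; among the parts ≥ a that are ≡ a or b (mod k), this
-- window contains only l itself and the nearest part of the other class below l (none if l = a).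
-- Hence G(m + 1, l) = w_l (G(m, l) + G(m, l′)) with w_l = μ q^l or ν q^l according to the class of l.
-- The closed forms satisfy the same recurrences and initial values: summand by summand this is the
-- q-Pascal rule [n+1; r+1]_k = [n; r]_k + q^{k(r+1)} [n; r+1]_k, valid because (q^k; q^k)_n ≠ 0 for
-- q ≠ ±1.  Induction on m then gives the theorem, g(m, l) being the case L = l.

open import Defs
open import Data.Nat as ℕ using (ℕ; NonZero; zero; suc; _≤_; _<_; _+_; _*_; _∸_; _%_; _/_; z≤n; s≤s)
open import Data.Nat.DivMod using (m≡m%n+[m/n]*n; [m+kn]%n≡m%n; m<n⇒m%n≡m; n%n≡0)
import Data.Nat.Properties as ℕP
open import Data.Integer as ℤ using (+_; _⊖_)
import Data.Integer.Properties as ℤP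
open import Data.Rational as ℚ using (ℚ; 0ℚ; 1ℚ; -_; ∣_∣)
import Data.Rational.Properties as ℚP
open import Data.Bool as Bool using (Bool; true; false; _∧_; _∨_; if_then_else_)
import Data.Bool.Properties as BoolP
open import Data.List using (List; []; _∷_; _++_; map; concatMap; filter; foldr)
open import Data.Product using (_×_; _,_; proj₁; proj₂; ∃; map₂)
open import Data.Sum using (_⊎_; inj₁; inj₂; [_,_])
open import Data.Maybe using (Maybe; just; nothing)
open import Data.Empty using (⊥-elim)
open import Relation.Nullary using (Dec; does; yes; no)
open import Relation.Nullary.Decidable using (dec-true; dec-false)
open import Relation.Binary.Definitions using (tri<; tri≈; tri>)
open import Relation.Binary.PropositionalEquality
  using (_≡_; _≢_; refl; sym; trans; cong; cong₂; subst; module ≡-Reasoning)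
open import Level using (0ℓ)
open import Tactic.RingSolver using (solve-∀)
import Tactic.RingSolver.Core.AlmostCommutativeRing as ACR
import Data.Nat.Tactic.RingSolver as ℕ-Ring

-- The solver needs a zero test on coefficients to cancel terms such as 1 − 1.
ℚ-isZero : (x : ℚ) → Maybe (0ℚ ≡ x)
ℚ-isZero x with x ℚP.≟ 0ℚ
... | yes x≡0 = just (sym x≡0)
... | no _    = nothing

ℚ-ring : ACR.AlmostCommutativeRing 0ℓ 0ℓ
ℚ-ring = ACR.fromCommutativeRing ℚP.+-*-commutativeRing ℚ-isZero

^-+ : ∀ x m n → x ^ (m + n) ≡ x ^ m ℚ.* x ^ n
^-+ x zero    n = sym (ℚP.*-identityˡ _)
^-+ x (suc m) n = trans (cong (x ℚ.*_) (^-+ x m n)) (sym (ℚP.*-assoc x (x ^ m) (x ^ n)))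

^-* : ∀ x m n → (x ^ m) ^ n ≡ x ^ (m * n)
^-* x m zero    = cong (x ^_) (sym (ℕP.*-zeroʳ m))
^-* x m (suc n) = begin
  x ^ m ℚ.* (x ^ m) ^ n ≡⟨ cong (x ^ m ℚ.*_) (^-* x m n) ⟩
  x ^ m ℚ.* x ^ (m * n) ≡⟨ sym (^-+ x m (m * n)) ⟩
  x ^ (m + m * n)       ≡⟨ cong (x ^_) (sym (ℕP.*-suc m n)) ⟩
  x ^ (m * suc n)       ∎
  where open ≡-Reasoning

rescale-+ : ∀ w x t y y′ → w ℚ.* y ≡ x → w ℚ.* y′ ≡ x ℚ.* t →
  ∀ e₀ e₁ → x ℚ.* (e₀ ℚ.+ t ℚ.* e₁) ≡ w ℚ.* (y ℚ.* e₀ ℚ.+ y′ ℚ.* e₁)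
rescale-+ w _ t y y′ refl wy′≡xt e₀ e₁ = begin
  w ℚ.* y ℚ.* (e₀ ℚ.+ t ℚ.* e₁)                 ≡⟨ expand (w ℚ.* y) t e₀ e₁ ⟩
  w ℚ.* y ℚ.* e₀ ℚ.+ (w ℚ.* y ℚ.* t) ℚ.* e₁     ≡⟨ cong (λ z → w ℚ.* y ℚ.* e₀ ℚ.+ z ℚ.* e₁) wy′≡xt ⟨
  w ℚ.* y ℚ.* e₀ ℚ.+ w ℚ.* y′ ℚ.* e₁            ≡⟨ collect w y y′ e₀ e₁ ⟩
  w ℚ.* (y ℚ.* e₀ ℚ.+ y′ ℚ.* e₁)                ∎
  where
  open ≡-Reasoning
  expand : ∀ (x t e₀ e₁ : ℚ) → x ℚ.* (e₀ ℚ.+ t ℚ.* e₁) ≡ x ℚ.* e₀ ℚ.+ (x ℚ.* t) ℚ.* e₁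
  expand = solve-∀ ℚ-ring
  collect : ∀ (w y y′ e₀ e₁ : ℚ) → w ℚ.* y ℚ.* e₀ ℚ.+ w ℚ.* y′ ℚ.* e₁ ≡ w ℚ.* (y ℚ.* e₀ ℚ.+ y′ ℚ.* e₁)
  collect = solve-∀ ℚ-ring

rescale-* : ∀ w x y c c′ d → w ℚ.* y ≡ x → c ≡ c′ → x ℚ.* c ℚ.* d ≡ w ℚ.* (y ℚ.* c′ ℚ.* d)
rescale-* w _ y c _ d refl refl = trans (cong (ℚ._* d) (ℚP.*-assoc w y c)) (ℚP.*-assoc w (y ℚ.* c) d)

sumℚ-cong : ∀ n {f g : ℕ → ℚ} → (∀ i → f i ≡ g i) → sumℚ n f ≡ sumℚ n g
sumℚ-cong zero    f≡g = refl
sumℚ-cong (suc n) f≡g = cong₂ ℚ._+_ (sumℚ-cong n f≡g) (f≡g n)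

sumℚ-+ : ∀ n (f g : ℕ → ℚ) → sumℚ n (λ i → f i ℚ.+ g i) ≡ sumℚ n f ℚ.+ sumℚ n g
sumℚ-+ zero    f g = refl
sumℚ-+ (suc n) f g = trans (cong (ℚ._+ (f n ℚ.+ g n)) (sumℚ-+ n f g)) (interchange (sumℚ n f) (sumℚ n g) (f n) (g n))
  where
  interchange : ∀ (w x y z : ℚ) → (w ℚ.+ x) ℚ.+ (y ℚ.+ z) ≡ (w ℚ.+ y) ℚ.+ (x ℚ.+ z)
  interchange = solve-∀ ℚ-ring

sumℚ-*ˡ : ∀ n c (f : ℕ → ℚ) → sumℚ n (λ i → c ℚ.* f i) ≡ c ℚ.* sumℚ n f
sumℚ-*ˡ zero    c f = sym (ℚP.*-zeroʳ c)
sumℚ-*ˡ (suc n) c f =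
  trans (cong (ℚ._+ c ℚ.* f n) (sumℚ-*ˡ n c f)) (sym (ℚP.*-distribˡ-+ c (sumℚ n f) (f n)))

sumℚ-suc : ∀ n (f : ℕ → ℚ) → sumℚ (suc n) f ≡ f 0 ℚ.+ sumℚ n (λ i → f (suc i))
sumℚ-suc zero    f = trans (ℚP.+-identityˡ (f 0)) (sym (ℚP.+-identityʳ (f 0)))
sumℚ-suc (suc n) f = trans (cong (ℚ._+ f (suc n)) (sumℚ-suc n f)) (ℚP.+-assoc (f 0) _ _)

sumℚ-last-≡0 : ∀ n (f : ℕ → ℚ) → f n ≡ 0ℚ → sumℚ (suc n) f ≡ sumℚ n f
sumℚ-last-≡0 n f fn≡0 = trans (cong (sumℚ n f ℚ.+_) fn≡0) (ℚP.+-identityʳ (sumℚ n f))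

sumL : ∀ {A : Set} → (A → ℚ) → List A → ℚ
sumL F []       = 0ℚ
sumL F (x ∷ xs) = F x ℚ.+ sumL F xs

module _ {A : Set} where

  sumL-cong : ∀ {F G : A → ℚ} xs → (∀ x → F x ≡ G x) → sumL F xs ≡ sumL G xs
  sumL-cong []       F≡G = refl
  sumL-cong (x ∷ xs) F≡G = cong₂ ℚ._+_ (F≡G x) (sumL-cong xs F≡G)

  sumL-0 : ∀ (xs : List A) → sumL (λ _ → 0ℚ) xs ≡ 0ℚ
  sumL-0 []       = refl
  sumL-0 (x ∷ xs) = trans (ℚP.+-identityˡ _) (sumL-0 xs)

  sumL-++ : ∀ (F : A → ℚ) xs ys → sumL F (xs ++ ys) ≡ sumL F xs ℚ.+ sumL F ys
  sumL-++ F []       ys = sym (ℚP.+-identityˡ (sumL F ys))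
  sumL-++ F (x ∷ xs) ys = trans (cong (F x ℚ.+_) (sumL-++ F xs ys)) (sym (ℚP.+-assoc (F x) (sumL F xs) (sumL F ys)))

  sumL-*ˡ : ∀ c (F : A → ℚ) xs → sumL (λ x → c ℚ.* F x) xs ≡ c ℚ.* sumL F xs
  sumL-*ˡ c F []       = sym (ℚP.*-zeroʳ c)
  sumL-*ˡ c F (x ∷ xs) = trans (cong (c ℚ.* F x ℚ.+_) (sumL-*ˡ c F xs)) (sym (ℚP.*-distribˡ-+ c (F x) (sumL F xs)))

  sumL-+ : ∀ (F G : A → ℚ) xs → sumL (λ x → F x ℚ.+ G x) xs ≡ sumL F xs ℚ.+ sumL G xs
  sumL-+ F G []       = refl
  sumL-+ F G (x ∷ xs) = trans (cong (F x ℚ.+ G x ℚ.+_) (sumL-+ F G xs))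
                              (interchange (F x) (G x) (sumL F xs) (sumL G xs))
    where
    interchange : ∀ (w x y z : ℚ) → (w ℚ.+ x) ℚ.+ (y ℚ.+ z) ≡ (w ℚ.+ y) ℚ.+ (x ℚ.+ z)
    interchange = solve-∀ ℚ-ring

  sumL-filter : ∀ (p : A → Bool) (F : A → ℚ) xs →
    foldr ℚ._+_ 0ℚ (map F (filter (λ x → p x Bool.≟ true) xs)) ≡ sumL (λ x → if p x then F x else 0ℚ) xs
  sumL-filter p F []       = refl
  sumL-filter p F (x ∷ xs) with p x
  ... | true  = cong (F x ℚ.+_) (sumL-filter p F xs)
  ... | false = trans (sumL-filter p F xs) (sym (ℚP.+-identityˡ _))

sumL-map : ∀ {A B : Set} (F : B → ℚ) (f : A → B) xs → sumL F (map f xs) ≡ sumL (λ x → F (f x)) xs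
sumL-map F f []       = refl
sumL-map F f (x ∷ xs) = cong (F (f x) ℚ.+_) (sumL-map F f xs)

sumL-concatMap : ∀ {A B : Set} (F : B → ℚ) (f : A → List B) xs →
                 sumL F (concatMap f xs) ≡ sumL (λ x → sumL F (f x)) xs
sumL-concatMap F f []       = refl
sumL-concatMap F f (x ∷ xs) = trans (sumL-++ F (f x) (concatMap f xs)) (cong (sumL F (f x) ℚ.+_) (sumL-concatMap F f xs))

sumL-allLists-suc : ∀ m L (F : List ℕ → ℚ) →
  sumL F (allLists (suc m) L) ≡ sumL (λ xs → sumL (λ ys → F (ys ++ xs)) (allLists 1 L)) (allLists m L)
sumL-allLists-suc m L F = prepend-heads _ (allLists m L)
  where
  -- The list of candidate heads is local to allLists, so the lemma is stated for an arbitrary one.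
  prepend-heads : ∀ R xss → sumL F (concatMap (λ xs → map (_∷ xs) R) xss)
    ≡ sumL (λ xs → sumL (λ ys → F (ys ++ xs)) (map (_∷ []) R ++ [])) xss
  prepend-heads R xss = trans (sumL-concatMap F (λ xs → map (_∷ xs) R) xss) (sumL-cong xss λ xs → begin
    sumL F (map (_∷ xs) R)                               ≡⟨ sumL-map F (_∷ xs) R ⟩
    sumL (λ y → F (y ∷ xs)) R                            ≡⟨ sumL-map (λ ys → F (ys ++ xs)) (_∷ []) R ⟨
    sumL (λ ys → F (ys ++ xs)) (map (_∷ []) R)           ≡⟨ ℚP.+-identityʳ _ ⟨
    sumL (λ ys → F (ys ++ xs)) (map (_∷ []) R) ℚ.+ 0ℚ    ≡⟨ sumL-++ (λ ys → F (ys ++ xs)) (map (_∷ []) R) [] ⟨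
    sumL (λ ys → F (ys ++ xs)) (map (_∷ []) R ++ [])     ∎)
    where open ≡-Reasoning

sumL-singletons-cong : ∀ L {G G′ : List ℕ → ℚ} → (∀ x → G (x ∷ []) ≡ G′ (x ∷ [])) →
                       sumL G (allLists 1 L) ≡ sumL G′ (allLists 1 L)
sumL-singletons-cong zero    G≡G′ = cong (ℚ._+ 0ℚ) (G≡G′ 0)
sumL-singletons-cong (suc L) {G} {G′} G≡G′ = cong₂ ℚ._+_ (G≡G′ (suc L)) (sumL-singletons-cong L {G} {G′} G≡G′)

sumL-singletons-≡0 : ∀ L (G : List ℕ → ℚ) → (∀ x → x ≤ L → G (x ∷ []) ≡ 0ℚ) → sumL G (allLists 1 L) ≡ 0ℚ
sumL-singletons-≡0 zero    G G≡0 = cong (ℚ._+ 0ℚ) (G≡0 0 z≤n)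
sumL-singletons-≡0 (suc L) G G≡0 =
  cong₂ ℚ._+_ (G≡0 (suc L) ℕP.≤-refl) (sumL-singletons-≡0 L G (λ x x≤L → G≡0 x (ℕP.m≤n⇒m≤1+n x≤L)))

sumL-singletons-at : ∀ L l (G : List ℕ → ℚ) → l ≤ L → (∀ x → x ≢ l → G (x ∷ []) ≡ 0ℚ) →
                     sumL G (allLists 1 L) ≡ G (l ∷ [])
sumL-singletons-at zero    zero G _ _ = ℚP.+-identityʳ (G (0 ∷ []))
sumL-singletons-at (suc L) l G l≤1+L G≡0 with l ℕP.≟ suc L
... | yes refl = trans (cong (G (suc L ∷ []) ℚ.+_) (sumL-singletons-≡0 L G λ x x≤L → G≡0 x λ { refl → ℕP.1+n≰n x≤L }))
                       (ℚP.+-identityʳ _)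
... | no l≢1+L = trans (cong₂ ℚ._+_ (G≡0 (suc L) (λ 1+L≡l → l≢1+L (sym 1+L≡l)))
                                    (sumL-singletons-at L l G (ℕP.≤-pred (ℕP.≤∧≢⇒< l≤1+L l≢1+L)) G≡0))
                       (ℚP.+-identityˡ _)

sumL-allLists-cong : ∀ m L {F F′ : List ℕ → ℚ} → (∀ y ys → F (y ∷ ys) ≡ F′ (y ∷ ys)) →
                     sumL F (allLists (suc m) L) ≡ sumL F′ (allLists (suc m) L)
sumL-allLists-cong m L {F} {F′} F≡F′ = begin
  sumL F (allLists (suc m) L)
    ≡⟨ sumL-allLists-suc m L F ⟩
  sumL (λ xs → sumL (λ ys → F (ys ++ xs)) (allLists 1 L)) (allLists m L)
    ≡⟨ sumL-cong (allLists m L) (λ xs → sumL-singletons-cong L {λ ys → F (ys ++ xs)} {λ ys → F′ (ys ++ xs)} (λ y → F≡F′ y xs)) ⟩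
  sumL (λ xs → sumL (λ ys → F′ (ys ++ xs)) (allLists 1 L)) (allLists m L)
    ≡⟨ sumL-allLists-suc m L F′ ⟨
  sumL F′ (allLists (suc m) L) ∎
  where open ≡-Reasoning

-- Gaussian binomial coefficients

∣^∣ : ∀ x n → ∣ x ^ n ∣ ≡ ∣ x ∣ ^ n
∣^∣ x zero    = refl
∣^∣ x (suc n) = trans (ℚP.∣p*q∣≡∣p∣*∣q∣ x (x ^ n)) (cong (∣ x ∣ ℚ.*_) (∣^∣ x n))

module _ (p : ℚ) .{{_ : ℚ.NonNegative p}} where

  ^-≤-1 : p ℚ.≤ 1ℚ → ∀ n → p ^ n ℚ.≤ 1ℚ
  ^-≤-1 p≤1 zero    = ℚP.≤-refl
  ^-≤-1 p≤1 (suc n) = begin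
    p ℚ.* p ^ n ≤⟨ ℚP.*-monoˡ-≤-nonNeg p (^-≤-1 p≤1 n) ⟩
    p ℚ.* 1ℚ    ≡⟨ ℚP.*-identityʳ p ⟩
    p           ≤⟨ p≤1 ⟩
    1ℚ          ∎
    where open ℚP.≤-Reasoning

  ^-≥-1 : 1ℚ ℚ.≤ p → ∀ n → 1ℚ ℚ.≤ p ^ n
  ^-≥-1 1≤p zero    = ℚP.≤-refl
  ^-≥-1 1≤p (suc n) = begin
    1ℚ          ≤⟨ 1≤p ⟩
    p           ≡⟨ ℚP.*-identityʳ p ⟨
    p ℚ.* 1ℚ    ≤⟨ ℚP.*-monoˡ-≤-nonNeg p (^-≥-1 1≤p n) ⟩
    p ℚ.* p ^ n ∎
    where open ℚP.≤-Reasoning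

^-suc-≢1 : ∀ {q} → q ≢ 1ℚ → q ≢ - 1ℚ → ∀ n → q ^ suc n ≢ 1ℚ
^-suc-≢1 {q} q≢1 q≢-1 n qⁿ⁺¹≡1 with ℚP.<-cmp ∣ q ∣ 1ℚ
... | tri< ∣q∣<1 _ _ = ℚP.<-irrefl ∣q∣ⁿ⁺¹≡1 (begin-strict
  ∣ q ∣ ℚ.* ∣ q ∣ ^ n ≤⟨ ℚP.*-monoˡ-≤-nonNeg ∣ q ∣ (^-≤-1 ∣ q ∣ (ℚP.<⇒≤ ∣q∣<1) n) ⟩
  ∣ q ∣ ℚ.* 1ℚ        ≡⟨ ℚP.*-identityʳ ∣ q ∣ ⟩
  ∣ q ∣               <⟨ ∣q∣<1 ⟩
  1ℚ                  ∎)
  where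
  open ℚP.≤-Reasoning
  instance _ = ℚP.∣-∣-nonNeg q
  ∣q∣ⁿ⁺¹≡1 : ∣ q ∣ ^ suc n ≡ 1ℚ
  ∣q∣ⁿ⁺¹≡1 = trans (sym (∣^∣ q (suc n))) (cong ∣_∣ qⁿ⁺¹≡1)
... | tri> _ _ 1<∣q∣ = ℚP.<-irrefl (sym ∣q∣ⁿ⁺¹≡1) (begin-strict
  1ℚ                  <⟨ 1<∣q∣ ⟩
  ∣ q ∣               ≡⟨ ℚP.*-identityʳ ∣ q ∣ ⟨
  ∣ q ∣ ℚ.* 1ℚ        ≤⟨ ℚP.*-monoˡ-≤-nonNeg ∣ q ∣ (^-≥-1 ∣ q ∣ (ℚP.<⇒≤ 1<∣q∣) n) ⟩
  ∣ q ∣ ℚ.* ∣ q ∣ ^ n ∎)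
  where
  open ℚP.≤-Reasoning
  instance _ = ℚP.∣-∣-nonNeg q
  ∣q∣ⁿ⁺¹≡1 : ∣ q ∣ ^ suc n ≡ 1ℚ
  ∣q∣ⁿ⁺¹≡1 = trans (sym (∣^∣ q (suc n))) (cong ∣_∣ qⁿ⁺¹≡1)
... | tri≈ _ ∣q∣≡1 _ with ℚP.∣p∣≡p∨∣p∣≡-p q
...   | inj₁ ∣q∣≡q  = q≢1 (trans (sym ∣q∣≡q) ∣q∣≡1)
...   | inj₂ ∣q∣≡-q = q≢-1 (ℚP.neg-injective (trans (sym ∣q∣≡-q) ∣q∣≡1))

*-≢0 : ∀ {x y} → x ≢ 0ℚ → y ≢ 0ℚ → x ℚ.* y ≢ 0ℚ
*-≢0 {x} {y} x≢0 y≢0 xy≡0 = y≢0 (begin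
  y                  ≡⟨ ℚP.*-identityˡ y ⟨
  1ℚ ℚ.* y           ≡⟨ cong (ℚ._* y) (ℚP.*-inverseˡ x) ⟨
  (x⁻¹ ℚ.* x) ℚ.* y  ≡⟨ ℚP.*-assoc x⁻¹ x y ⟩
  x⁻¹ ℚ.* (x ℚ.* y)  ≡⟨ cong (x⁻¹ ℚ.*_) xy≡0 ⟩
  x⁻¹ ℚ.* 0ℚ         ≡⟨ ℚP.*-zeroʳ x⁻¹ ⟩
  0ℚ                 ∎)
  where
  open ≡-Reasoning
  instance _ = ℚ.≢-nonZero x≢0
  x⁻¹ = ℚ.1/ x

1-x≢0 : ∀ {x} → x ≢ 1ℚ → 1ℚ ℚ.- x ≢ 0ℚ
1-x≢0 {x} x≢1 1-x≡0 = x≢1 (begin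
  x                  ≡⟨ cancel x ⟩
  1ℚ ℚ.- (1ℚ ℚ.- x)  ≡⟨ cong (λ z → 1ℚ ℚ.- z) 1-x≡0 ⟩
  1ℚ                 ∎)
  where
  open ≡-Reasoning
  cancel : ∀ (y : ℚ) → y ≡ 1ℚ ℚ.- (1ℚ ℚ.- y)
  cancel = solve-∀ ℚ-ring

safeDiv-unique : ∀ {A C D} → D ≢ 0ℚ → A ≡ C ℚ.* D → safeDiv A D ≡ C
safeDiv-unique {A} {C} {D} D≢0 A≡CD with D ℚP.≟ 0ℚ
... | yes D≡0 = ⊥-elim (D≢0 D≡0)
... | no D≢0′ = begin
  A ℚ.* D⁻¹          ≡⟨ cong (ℚ._* D⁻¹) A≡CD ⟩
  (C ℚ.* D) ℚ.* D⁻¹  ≡⟨ ℚP.*-assoc C D D⁻¹ ⟩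
  C ℚ.* (D ℚ.* D⁻¹)  ≡⟨ cong (C ℚ.*_) (ℚP.*-inverseʳ D) ⟩
  C ℚ.* 1ℚ           ≡⟨ ℚP.*-identityʳ C ⟩
  C                  ∎
  where
  open ≡-Reasoning
  instance _ = ℚ.≢-nonZero D≢0′
  D⁻¹ = ℚ.1/ D

module Gauss (Q : ℚ) where

  gauss : ℕ → ℕ → ℚ
  gauss zero    zero    = 1ℚ
  gauss zero    (suc r) = 0ℚ
  gauss (suc n) zero    = 1ℚ
  gauss (suc n) (suc r) = gauss n r ℚ.+ Q ^ suc r ℚ.* gauss n (suc r)

  gauss-≡0 : ∀ {n r} → n < r → gauss n r ≡ 0ℚ
  gauss-≡0 {zero}  {suc r} _         = refl
  gauss-≡0 {suc n} {suc r} (s≤s n<r) = begin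
    gauss n r ℚ.+ Q ^ suc r ℚ.* gauss n (suc r) ≡⟨ cong₂ (λ x y → x ℚ.+ Q ^ suc r ℚ.* y)
                                                      (gauss-≡0 n<r) (gauss-≡0 (ℕP.m<n⇒m<1+n n<r)) ⟩
    0ℚ ℚ.+ Q ^ suc r ℚ.* 0ℚ                     ≡⟨ cong (0ℚ ℚ.+_) (ℚP.*-zeroʳ (Q ^ suc r)) ⟩
    0ℚ                                          ∎
    where open ≡-Reasoning

  gauss-zero : ∀ n → gauss n 0 ≡ 1ℚ
  gauss-zero zero    = refl
  gauss-zero (suc n) = refl

  gauss-diag : ∀ n → gauss n n ≡ 1ℚ
  gauss-diag zero    = refl
  gauss-diag (suc n) = begin
    gauss n n ℚ.+ Q ^ suc n ℚ.* gauss n (suc n) ≡⟨ cong₂ (λ x y → x ℚ.+ Q ^ suc n ℚ.* y)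
                                                      (gauss-diag n) (gauss-≡0 (ℕP.n<1+n n)) ⟩
    1ℚ ℚ.+ Q ^ suc n ℚ.* 0ℚ                     ≡⟨ cong (1ℚ ℚ.+_) (ℚP.*-zeroʳ (Q ^ suc n)) ⟩
    1ℚ                                          ∎
    where open ≡-Reasoning

  poch : ℕ → ℚ
  poch = qPoch Q Q

  -- The Pascal recursion of gauss matches (Q;Q)_{n+1} = (Q;Q)_n (1 - Q^{r+1} Q^{n-r}),
  -- split as (1 - Q^{r+1}) + Q^{r+1} (1 - Q^{n-r}).
  gauss-poch : ∀ n r → r ≤ n → gauss n r ℚ.* (poch r ℚ.* poch (n ∸ r)) ≡ poch n
  gauss-poch zero    zero    _ = refl
  gauss-poch (suc n) zero    _ = trans (ℚP.*-identityˡ _) (ℚP.*-identityˡ _)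
  gauss-poch (suc n) (suc r) (s≤s r≤n) with ℕP.m≤n⇒m<n∨m≡n r≤n
  ... | inj₂ refl = begin
    gauss (suc r) (suc r) ℚ.* (poch (suc r) ℚ.* poch (r ∸ r)) ≡⟨ cong₂ (λ x y → x ℚ.* (poch (suc r) ℚ.* poch y))
                                                                     (gauss-diag (suc r)) (ℕP.n∸n≡0 r) ⟩
    1ℚ ℚ.* (poch (suc r) ℚ.* 1ℚ)                              ≡⟨ ℚP.*-identityˡ _ ⟩
    poch (suc r) ℚ.* 1ℚ                                       ≡⟨ ℚP.*-identityʳ _ ⟩
    poch (suc r)                                              ∎
    where open ≡-Reasoning
  ... | inj₁ r<n = begin
    (gauss n r ℚ.+ X ℚ.* gauss n (suc r)) ℚ.* ((poch r ℚ.* (1ℚ ℚ.- X)) ℚ.* poch (n ∸ r))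
      ≡⟨ cong (λ z → (gauss n r ℚ.+ X ℚ.* gauss n (suc r)) ℚ.* ((poch r ℚ.* (1ℚ ℚ.- X)) ℚ.* poch z)) n∸r≡1+u ⟩
    (gauss n r ℚ.+ X ℚ.* gauss n (suc r)) ℚ.* ((poch r ℚ.* (1ℚ ℚ.- X)) ℚ.* (poch u ℚ.* (1ℚ ℚ.- Y)))
      ≡⟨ distribute (gauss n r) (gauss n (suc r)) (poch r) (poch u) X Y ⟩
    (1ℚ ℚ.- X) ℚ.* (gauss n r ℚ.* (poch r ℚ.* (poch u ℚ.* (1ℚ ℚ.- Y))))
      ℚ.+ (X ℚ.* (1ℚ ℚ.- Y)) ℚ.* (gauss n (suc r) ℚ.* (poch (suc r) ℚ.* poch u))
      ≡⟨ cong₂ (λ x y → (1ℚ ℚ.- X) ℚ.* x ℚ.+ (X ℚ.* (1ℚ ℚ.- Y)) ℚ.* y) lower upper ⟩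
    (1ℚ ℚ.- X) ℚ.* poch n ℚ.+ (X ℚ.* (1ℚ ℚ.- Y)) ℚ.* poch n
      ≡⟨ merge X Y (poch n) ⟩
    poch n ℚ.* (1ℚ ℚ.- X ℚ.* Y)
      ≡⟨ cong (λ z → poch n ℚ.* (1ℚ ℚ.- z)) XY≡Qⁿ⁺¹ ⟩
    poch n ℚ.* (1ℚ ℚ.- Q ℚ.* Q ^ n) ∎
    where
    open ≡-Reasoning
    u = n ∸ suc r
    X = Q ^ suc r
    Y = Q ^ suc u
    n∸r≡1+u : n ∸ r ≡ suc u
    n∸r≡1+u = ℕP.+-∸-assoc 1 r<n
    XY≡Qⁿ⁺¹ : X ℚ.* Y ≡ Q ℚ.* Q ^ n
    XY≡Qⁿ⁺¹ = trans (sym (^-+ Q (suc r) (suc u)))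
              (cong (Q ^_) (cong suc (trans (ℕP.+-suc r u) (ℕP.m+[n∸m]≡n r<n))))
    lower : gauss n r ℚ.* (poch r ℚ.* (poch u ℚ.* (1ℚ ℚ.- Y))) ≡ poch n
    lower = trans (cong (λ z → gauss n r ℚ.* (poch r ℚ.* poch z)) (sym n∸r≡1+u)) (gauss-poch n r r≤n)
    upper : gauss n (suc r) ℚ.* (poch (suc r) ℚ.* poch u) ≡ poch n
    upper = gauss-poch n (suc r) r<n
    distribute : ∀ (g₀ g₁ pᵣ pᵤ x y : ℚ) →
      (g₀ ℚ.+ x ℚ.* g₁) ℚ.* ((pᵣ ℚ.* (1ℚ ℚ.- x)) ℚ.* (pᵤ ℚ.* (1ℚ ℚ.- y)))
        ≡ (1ℚ ℚ.- x) ℚ.* (g₀ ℚ.* (pᵣ ℚ.* (pᵤ ℚ.* (1ℚ ℚ.- y))))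
          ℚ.+ (x ℚ.* (1ℚ ℚ.- y)) ℚ.* (g₁ ℚ.* ((pᵣ ℚ.* (1ℚ ℚ.- x)) ℚ.* pᵤ))
    distribute = solve-∀ ℚ-ring
    merge : ∀ (x y p : ℚ) → (1ℚ ℚ.- x) ℚ.* p ℚ.+ (x ℚ.* (1ℚ ℚ.- y)) ℚ.* p ≡ p ℚ.* (1ℚ ℚ.- x ℚ.* y)
    merge = solve-∀ ℚ-ring

  poch-≢0 : (∀ j → Q ^ suc j ≢ 1ℚ) → ∀ n → poch n ≢ 0ℚ
  poch-≢0 Qʲ≢1 zero    = λ ()
  poch-≢0 Qʲ≢1 (suc n) = *-≢0 (poch-≢0 Qʲ≢1 n) (1-x≢0 (Qʲ≢1 n))

open Gauss using (gauss)

qbinNat-≡0 : ∀ q k {n r} → n < r → qbinNat q k n r ≡ 0ℚ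
qbinNat-≡0 q k {n} {r} n<r with r ℕP.≤? n
... | yes r≤n = ⊥-elim (ℕP.<⇒≱ n<r r≤n)
... | no _    = refl

^ᵏ-suc-≢1 : ∀ {q} k .{{_ : NonZero k}} → q ≢ 1ℚ → q ≢ - 1ℚ → ∀ j → (q ^ k) ^ suc j ≢ 1ℚ
^ᵏ-suc-≢1 {q} (suc k′) q≢1 q≢-1 j qᵏʲ⁺¹≡1 =
  ^-suc-≢1 q≢1 q≢-1 (j + k′ * suc j) (trans (sym (^-* q (suc k′) (suc j))) qᵏʲ⁺¹≡1)

module _ {q : ℚ} (k : ℕ) {{_ : NonZero k}} (q≢1 : q ≢ 1ℚ) (q≢-1 : q ≢ - 1ℚ) where

  qbinNat≡gauss : ∀ n r → qbinNat q k n r ≡ gauss (q ^ k) n r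
  qbinNat≡gauss n r with r ℕP.≤? n
  ... | yes r≤n = safeDiv-unique (*-≢0 (poch≢0 r) (poch≢0 (n ∸ r))) (sym (Gauss.gauss-poch (q ^ k) n r r≤n))
    where
    poch≢0 : ∀ n → qkPoch q k n ≢ 0ℚ
    poch≢0 = Gauss.poch-≢0 (q ^ k) (^ᵏ-suc-≢1 k q≢1 q≢-1)
  ... | no r≰n  = sym (Gauss.gauss-≡0 (q ^ k) (ℕP.≰⇒> r≰n))

  qbinNat-pascal : ∀ n r →
    qbinNat q k (suc n) (suc r) ≡ qbinNat q k n r ℚ.+ (q ^ k) ^ suc r ℚ.* qbinNat q k n (suc r)
  qbinNat-pascal n r rewrite qbinNat≡gauss (suc n) (suc r) | qbinNat≡gauss n r | qbinNat≡gauss n (suc r) = refl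

  qbinNat-zero : ∀ n → qbinNat q k n 0 ≡ 1ℚ
  qbinNat-zero n = trans (qbinNat≡gauss n 0) (Gauss.gauss-zero (q ^ k) n)

  qbinNat-diag : ∀ n → qbinNat q k n n ≡ 1ℚ
  qbinNat-diag n = trans (qbinNat≡gauss n n) (Gauss.gauss-diag (q ^ k) n)

+-+-≡⊖ : ∀ M n j → + M ℤ.- + n ℤ.- + j ≡ M ⊖ (n + j)
+-+-≡⊖ M n j = begin
  (+ M ℤ.+ ℤ.- + n) ℤ.+ ℤ.- + j  ≡⟨ ℤP.+-assoc (+ M) (ℤ.- + n) (ℤ.- + j) ⟩
  + M ℤ.+ (ℤ.- + n ℤ.+ ℤ.- + j)  ≡⟨ cong (λ z → + M ℤ.+ z) (ℤP.neg-distrib-+ (+ n) (+ j)) ⟨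
  + M ℤ.- + (n + j)              ≡⟨ ℤP.m-n≡m⊖n M (n + j) ⟩
  M ⊖ (n + j)                    ∎
  where open ≡-Reasoning

+-+-+-≡⊖ : ∀ M n j l → + M ℤ.- + n ℤ.- + j ℤ.- + l ≡ M ⊖ (n + j + l)
+-+-+-≡⊖ M n j l = begin
  + M ℤ.- + n ℤ.- + j ℤ.- + l ≡⟨ cong (ℤ._- + l) (+-+-≡⊖ M n j) ⟩
  M ⊖ (n + j) ℤ.- + l         ≡⟨ cong (ℤ._- + l) (ℤP.m-n≡m⊖n M (n + j)) ⟨
  + M ℤ.- + (n + j) ℤ.- + l   ≡⟨ +-+-≡⊖ M (n + j) l ⟩
  M ⊖ (n + j + l)             ∎
  where open ≡-Reasoning

module _ (q : ℚ) (k : ℕ) where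

  qbin-⊖ : ∀ n d r → qbin q k ((n + d) ⊖ n) (+ r) ≡ qbinNat q k d r
  qbin-⊖ n d r rewrite ℤP.⊖-≥ (ℕP.m≤m+n n d) | ℕP.m+n∸m≡n n d = refl

  qbin-⊖-≡0 : ∀ M n r → M < n + r → qbin q k (M ⊖ n) (+ r) ≡ 0ℚ
  qbin-⊖-≡0 zero    zero    r 0<r     = qbinNat-≡0 q k 0<r
  qbin-⊖-≡0 zero    (suc n) r _       = refl
  qbin-⊖-≡0 (suc M) zero    r M<r     = qbinNat-≡0 q k M<r
  qbin-⊖-≡0 (suc M) (suc n) r (s≤s M<n+r) =
    trans (cong (λ z → qbin q k z (+ r)) (ℤP.[1+m]⊖[1+n]≡m⊖n M n)) (qbin-⊖-≡0 M n r M<n+r)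

∨-true : ∀ x y → x ∨ y ≡ true → x ≡ true ⊎ y ≡ true
∨-true true  _ _     = inj₁ refl
∨-true false _ y≡tt = inj₂ y≡tt

if-*ˡ : ∀ t w x → (if t then w ℚ.* x else 0ℚ) ≡ w ℚ.* (if t then x else 0ℚ)
if-*ˡ true  w x = refl
if-*ˡ false w x = sym (ℚP.*-zeroʳ w)

if-∨ : ∀ v {t e₁ e₂} x → (v ≡ true → t ≡ e₁ ∨ e₂) → (e₁ ≡ true → e₂ ≡ false) →
       (if v ∧ t then x else 0ℚ) ≡ (if v ∧ e₁ then x else 0ℚ) ℚ.+ (if v ∧ e₂ then x else 0ℚ)
if-∨ false x _ _ = refl
if-∨ true {e₁ = e₁} {e₂} x t≡e₁∨e₂ exclusive rewrite t≡e₁∨e₂ refl with e₁ | e₂ | exclusive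
... | true  | true  | excl with () ← excl refl
... | true  | false | _ = sym (ℚP.+-identityʳ x)
... | false | true  | _ = sym (ℚP.+-identityˡ x)
... | false | false | _ = refl

does⇒ : ∀ {P : Set} (P? : Dec P) → does P? ≡ true → P
does⇒ (yes p) _ = p

≤-cases : ∀ {P : ℕ → Set} j → (∀ n → P (j + n)) → (∀ m → m < j → P m) → ∀ m → P m
≤-cases {P} j large small m with j ℕP.≤? m
... | yes j≤m = subst P (ℕP.m+[n∸m]≡n j≤m) (large (m ∸ j))
... | no j≰m  = small m (ℕP.≰⇒> j≰m)

≤-+-≡ : ∀ {m j j′} → m ≤ j → ∀ x → j + x ≡ j′ → m ≤ j′
≤-+-≡ {j = j} m≤j x refl = ℕP.≤-trans m≤j (ℕP.m≤m+n j x)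

+-∸-cancel : ∀ x y n → x + y + n ∸ x ∸ y ≡ n
+-∸-cancel x y n = trans (ℕP.∸-+-assoc (x + y + n) x y) (ℕP.m+n∸m≡n (x + y) n)

module Partitions (k a b : ℕ) {{_ : NonZero k}} (μ ν q : ℚ) where

  weightA : ℕ → ℚ
  weightA l = μ ℚ.* q ^ l

  weightB : ℕ → ℚ
  weightB l = ν ℚ.* q ^ l

  closed-a : ℕ → ℚ
  closed-a m = μ ^ m ℚ.* q ^ (m * a)

  next-multiple : ∀ h c → k * h + c + k ≡ k * suc h + c
  next-multiple h c = regroup k h c
    where
    regroup : ∀ k h c → k * h + c + k ≡ k * suc h + c
    regroup = ℕ-Ring.solve-∀

  class-≤ : ∀ {c d} h → c ≤ k + d → k * h + c ≤ k * suc h + d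
  class-≤ {c} {d} h c≤k+d = begin
    k * h + c       ≤⟨ ℕP.+-monoʳ-≤ (k * h) c≤k+d ⟩
    k * h + (k + d) ≡⟨ regroup k h d ⟩
    k * suc h + d   ∎
    where
    open ℕP.≤-Reasoning
    regroup : ∀ k h d → k * h + (k + d) ≡ k * suc h + d
    regroup = ℕ-Ring.solve-∀

  wt : List ℕ → ℚ
  wt = weight k a b μ ν q

  admissible : ℕ → Bool
  admissible y = congB k a b y a ∨ congB k a b y b

  valid : List ℕ → Bool
  valid xs = partsOK k a b xs ∧ chainOK k a b xs

  Window : ℕ → ℕ → Set
  Window l y = y ≤ l × l < y + k

  window : ℕ → ℕ → Bool
  window l y = does (y ℕ.≤? l) ∧ does (l ℕ.<? y + k)

  contrib : ℕ → List ℕ → ℚ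
  contrib l xs = if inB k a b l xs then wt xs else 0ℚ

  partitionSum : ℕ → ℕ → ℕ → ℚ
  partitionSum L m l = sumL (contrib l) (allLists m L)

  g≡partitionSum : ∀ m l → g k a b μ ν q m l ≡ partitionSum l m l
  g≡partitionSum m l = sumL-filter (inB k a b l) wt (allLists m l)

  record Recurrences (L : ℕ) (G : ℕ → ℕ → ℚ) : Set where
    field
      one-a  : a ≤ L → G 1 a ≡ weightA a
      one-b  : b ≤ L → G 1 b ≡ weightB b
      one-A  : ∀ h → k * suc h + a ≤ L → G 1 (k * suc h + a) ≡ 0ℚ
      one-B  : ∀ h → k * suc h + b ≤ L → G 1 (k * suc h + b) ≡ 0ℚ
      step-a : ∀ m → a ≤ L → G (2 + m) a ≡ weightA a ℚ.* G (suc m) a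
      step-A : ∀ m h → k * suc h + a ≤ L → G (2 + m) (k * suc h + a)
                 ≡ weightA (k * suc h + a) ℚ.* (G (suc m) (k * suc h + a) ℚ.+ G (suc m) (k * h + b))
      step-B : ∀ m h → k * h + b ≤ L → G (2 + m) (k * h + b)
                 ≡ weightB (k * h + b) ℚ.* (G (suc m) (k * h + b) ℚ.+ G (suc m) (k * h + a))

  monomial : ℕ → ℕ → ℕ → ℚ
  monomial x y z = μ ^ x ℚ.* ν ^ y ℚ.* q ^ z

  coeffA : ℕ → ℕ → ℕ → ℚ
  coeffA m h i = monomial (m ∸ h ∸ i) (h + i) (m * a + k * (h * h) + (b ∸ a) * (h + i))
    ℚ.* qbin q k (+ (h + i) ℤ.- + 1) (+ h ℤ.- + 1)

  termA : ℕ → ℕ → ℕ → ℚ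
  termA m h i = coeffA m h i ℚ.* qbin q k (+ m ℤ.- + h ℤ.- + i) (+ h)

  coeffB : ℕ → ℕ → ℕ → ℚ
  coeffB m h i = monomial (m ∸ h ∸ i ∸ 1) (h + i + 1) (m * a + k * (h * h) + k * h + (b ∸ a) * (h + i + 1))
    ℚ.* qbin q k (+ (h + i)) (+ h)

  termB : ℕ → ℕ → ℕ → ℚ
  termB m h i = coeffB m h i ℚ.* qbin q k (+ m ℤ.- + h ℤ.- + i ℤ.- + 1) (+ h)

  closedA : ℕ → ℕ → ℚ
  closedA m h = sumℚ (suc m) (termA m h)

  closedB : ℕ → ℕ → ℚ
  closedB m h = sumℚ (suc m) (termB m h)

  ClosedFormsHold : ℕ → (ℕ → ℕ → ℚ) → ℕ → Set
  ClosedFormsHold L G m =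
    (a ≤ L → G (suc m) a ≡ closed-a (suc m)) ×
    (∀ h → k * suc h + a ≤ L → G (suc m) (k * suc h + a) ≡ closedA (suc m) (suc h)) ×
    (∀ h → k * h + b ≤ L → G (suc m) (k * h + b) ≡ closedB (suc m) h)

  -- termA (h + i + n) h i and termB (h + i + 1 + n) h i, i.e. with n the number of μ-parts, where all
  -- binomial entries are natural numbers; termA′ is indexed by h − 1.
  termA′ : ℕ → ℕ → ℕ → ℚ
  termA′ h i n = monomial n (suc h + i) ((suc h + i + n) * a + k * (suc h * suc h) + (b ∸ a) * (suc h + i))
    ℚ.* qbinNat q k (h + i) h
    ℚ.* qbinNat q k n (suc h)

  termB′ : ℕ → ℕ → ℕ → ℚ
  termB′ h i n = monomial n (h + i + 1) ((h + i + 1 + n) * a + k * (h * h) + k * h + (b ∸ a) * (h + i + 1))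
    ℚ.* qbinNat q k (h + i) h
    ℚ.* qbinNat q k n h

  termA≡termA′ : ∀ {m} h i n → m ≡ suc h + i + n → termA m (suc h) i ≡ termA′ h i n
  termA≡termA′ h i n refl
    rewrite +-∸-cancel (suc h) i n | +-+-≡⊖ (suc h + i + n) (suc h) i | qbin-⊖ q k (suc h + i) n (suc h) = refl

  termB≡termB′ : ∀ {m} h i n → m ≡ h + i + 1 + n → termB m h i ≡ termB′ h i n
  termB≡termB′ h i n refl
    rewrite ℕP.∸-+-assoc (h + i + 1 + n) h i | ℕP.∸-+-assoc (h + i + 1 + n) (h + i) 1
          | ℕP.m+n∸m≡n (h + i + 1) n
          | +-+-+-≡⊖ (h + i + 1 + n) h i 1 | qbin-⊖ q k (h + i + 1) n h = refl

  termA-≡0 : ∀ m h i → m < h + i + h → termA m h i ≡ 0ℚ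
  termA-≡0 m h i m<h+i+h = trans (cong (coeffA m h i ℚ.*_)
    (trans (cong (λ z → qbin q k z (+ h)) (+-+-≡⊖ m h i)) (qbin-⊖-≡0 q k m (h + i) h m<h+i+h)))
    (ℚP.*-zeroʳ (coeffA m h i))

  termB-≡0 : ∀ m h i → m < h + i + 1 + h → termB m h i ≡ 0ℚ
  termB-≡0 m h i m<h+i+1+h = trans (cong (coeffB m h i ℚ.*_)
    (trans (cong (λ z → qbin q k z (+ h)) (+-+-+-≡⊖ m h i 1)) (qbin-⊖-≡0 q k m (h + i + 1) h m<h+i+1+h)))
    (ℚP.*-zeroʳ (coeffB m h i))

  weightA-monomial : ∀ l x y z → weightA l ℚ.* monomial x y z ≡ monomial (suc x) y (l + z)
  weightA-monomial l x y z = trans (regroup μ (q ^ l) (μ ^ x) (ν ^ y) (q ^ z))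
                                   (cong (μ ℚ.* μ ^ x ℚ.* ν ^ y ℚ.*_) (sym (^-+ q l z)))
    where
    regroup : ∀ (m ql mx ny qz : ℚ) → m ℚ.* ql ℚ.* (mx ℚ.* ny ℚ.* qz) ≡ m ℚ.* mx ℚ.* ny ℚ.* (ql ℚ.* qz)
    regroup = solve-∀ ℚ-ring

  weightB-monomial : ∀ l x y z → weightB l ℚ.* monomial x y z ≡ monomial x (suc y) (l + z)
  weightB-monomial l x y z = trans (regroup ν (q ^ l) (μ ^ x) (ν ^ y) (q ^ z))
                                   (cong (μ ^ x ℚ.* (ν ℚ.* ν ^ y) ℚ.*_) (sym (^-+ q l z)))
    where
    regroup : ∀ (n ql mx ny qz : ℚ) → n ℚ.* ql ℚ.* (mx ℚ.* ny ℚ.* qz) ≡ mx ℚ.* (n ℚ.* ny) ℚ.* (ql ℚ.* qz)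
    regroup = solve-∀ ℚ-ring

  monomial-qᵏ : ∀ x y z h → monomial x y z ℚ.* (q ^ k) ^ h ≡ monomial x y (z + k * h)
  monomial-qᵏ x y z h = begin
    μ ^ x ℚ.* ν ^ y ℚ.* q ^ z ℚ.* (q ^ k) ^ h   ≡⟨ cong (μ ^ x ℚ.* ν ^ y ℚ.* q ^ z ℚ.*_) (^-* q k h) ⟩
    μ ^ x ℚ.* ν ^ y ℚ.* q ^ z ℚ.* q ^ (k * h)   ≡⟨ ℚP.*-assoc (μ ^ x ℚ.* ν ^ y) (q ^ z) (q ^ (k * h)) ⟩
    μ ^ x ℚ.* ν ^ y ℚ.* (q ^ z ℚ.* q ^ (k * h)) ≡⟨ cong (μ ^ x ℚ.* ν ^ y ℚ.*_) (^-+ q z (k * h)) ⟨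
    μ ^ x ℚ.* ν ^ y ℚ.* q ^ (z + k * h)         ∎
    where open ≡-Reasoning

  -- The closed forms satisfy the recurrences

  module _ (q≢1 : q ≢ 1ℚ) (q≢-1 : q ≢ - 1ℚ) (a≤b : a ≤ b) where

    private
      b≡a+[b∸a] : b ≡ a + (b ∸ a)
      b≡a+[b∸a] = sym (ℕP.m+[n∸m]≡n a≤b)
      pascal = qbinNat-pascal k q≢1 q≢-1

    -- q-Pascal on the last binomial: its two pieces are the termB′ and, with the factor q^{k(h+1)}, the termA′ summand.
    termA′-suc : ∀ h i n → termA′ h i (suc n) ≡ weightA (k * suc h + a) ℚ.* (termA′ h i n ℚ.+ termB′ h i n)
    termA′-suc h i n = begin
      X ℚ.* C ℚ.* qbinNat q k (suc n) (suc h)           ≡⟨ cong (X ℚ.* C ℚ.*_) (pascal n h) ⟩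
      X ℚ.* C ℚ.* (P₀ ℚ.+ T ℚ.* P₁)                     ≡⟨ shuffle X C P₀ T P₁ ⟩
      X ℚ.* (C ℚ.* P₀ ℚ.+ T ℚ.* (C ℚ.* P₁))             ≡⟨ rescale-+ w X T YB YA wYB≡X wYA≡XT (C ℚ.* P₀) (C ℚ.* P₁) ⟩
      w ℚ.* (YB ℚ.* (C ℚ.* P₀) ℚ.+ YA ℚ.* (C ℚ.* P₁))   ≡⟨ unshuffle w YA YB C P₀ P₁ ⟩
      w ℚ.* (YA ℚ.* C ℚ.* P₁ ℚ.+ YB ℚ.* C ℚ.* P₀)       ∎
      where
      open ≡-Reasoning
      H = suc h
      w = weightA (k * H + a)
      E = (H + i + suc n) * a + k * (H * H) + (b ∸ a) * (H + i)
      EA = (H + i + n) * a + k * (H * H) + (b ∸ a) * (H + i)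
      EB = (h + i + 1 + n) * a + k * (h * h) + k * h + (b ∸ a) * (h + i + 1)
      X = monomial (suc n) (H + i) E
      YA = monomial n (H + i) EA
      YB = monomial n (h + i + 1) EB
      C = qbinNat q k (h + i) h
      P₀ = qbinNat q k n h
      P₁ = qbinNat q k n H
      T = (q ^ k) ^ H
      wYA≡XT : w ℚ.* YA ≡ X ℚ.* T
      wYA≡XT = trans (weightA-monomial (k * H + a) n (H + i) EA)
                     (trans (cong (monomial (suc n) (H + i)) (exponent k a (b ∸ a) h i n)) (sym (monomial-qᵏ (suc n) (H + i) E H)))
        where
        exponent : ∀ k a s h i n →
          k * suc h + a + ((suc h + i + n) * a + k * (suc h * suc h) + s * (suc h + i))
            ≡ (suc h + i + suc n) * a + k * (suc h * suc h) + s * (suc h + i) + k * suc h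
        exponent = ℕ-Ring.solve-∀
      wYB≡X : w ℚ.* YB ≡ X
      wYB≡X = trans (weightA-monomial (k * H + a) n (h + i + 1) EB)
                    (cong₂ (monomial (suc n)) (ℕP.+-comm (h + i) 1) (exponent k a (b ∸ a) h i n))
        where
        exponent : ∀ k a s h i n →
          k * suc h + a + ((h + i + 1 + n) * a + k * (h * h) + k * h + s * (h + i + 1))
            ≡ (suc h + i + suc n) * a + k * (suc h * suc h) + s * (suc h + i)
        exponent = ℕ-Ring.solve-∀
      shuffle : ∀ (x c p₀ t p₁ : ℚ) → x ℚ.* c ℚ.* (p₀ ℚ.+ t ℚ.* p₁) ≡ x ℚ.* (c ℚ.* p₀ ℚ.+ t ℚ.* (c ℚ.* p₁))
      shuffle = solve-∀ ℚ-ring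
      unshuffle : ∀ (w ya yb c p₀ p₁ : ℚ) →
        w ℚ.* (yb ℚ.* (c ℚ.* p₀) ℚ.+ ya ℚ.* (c ℚ.* p₁)) ≡ w ℚ.* (ya ℚ.* c ℚ.* p₁ ℚ.+ yb ℚ.* c ℚ.* p₀)
      unshuffle = solve-∀ ℚ-ring

    -- Here q-Pascal is applied to the first binomial instead.
    termB′-suc : ∀ h i n →
      termB′ (suc h) (suc i) n ≡ weightB (k * suc h + b) ℚ.* (termA′ h (suc i) n ℚ.+ termB′ (suc h) i n)
    termB′-suc h i n = begin
      X ℚ.* qbinNat q k (H + suc i) H ℚ.* D           ≡⟨ cong (λ c → X ℚ.* c ℚ.* D) (pascal (h + suc i) h) ⟩
      X ℚ.* (c₀ ℚ.+ T ℚ.* c₁) ℚ.* D                   ≡⟨ shuffle X c₀ T c₁ D ⟩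
      X ℚ.* (c₀ ℚ.* D ℚ.+ T ℚ.* (c₁ ℚ.* D))           ≡⟨ rescale-+ w X T YA YB wYA≡X wYB≡XT (c₀ ℚ.* D) (c₁ ℚ.* D) ⟩
      w ℚ.* (YA ℚ.* (c₀ ℚ.* D) ℚ.+ YB ℚ.* (c₁ ℚ.* D)) ≡⟨ unshuffle w YA YB c₀ c₁ D ⟩
      w ℚ.* (YA ℚ.* c₀ ℚ.* D ℚ.+ YB ℚ.* c₁ ℚ.* D)     ≡⟨ cong (λ z → w ℚ.* (YA ℚ.* c₀ ℚ.* D ℚ.+ YB ℚ.* qbinNat q k z H ℚ.* D))
                                                          (ℕP.+-suc h i) ⟩
      w ℚ.* (YA ℚ.* c₀ ℚ.* D ℚ.+ YB ℚ.* qbinNat q k (H + i) H ℚ.* D) ∎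
      where
      open ≡-Reasoning
      H = suc h
      w = weightB (k * H + b)
      E = (H + suc i + 1 + n) * a + k * (H * H) + k * H + (b ∸ a) * (H + suc i + 1)
      EA = (H + suc i + n) * a + k * (H * H) + (b ∸ a) * (H + suc i)
      EB = (H + i + 1 + n) * a + k * (H * H) + k * H + (b ∸ a) * (H + i + 1)
      X = monomial n (H + suc i + 1) E
      YA = monomial n (H + suc i) EA
      YB = monomial n (H + i + 1) EB
      c₀ = qbinNat q k (h + suc i) h
      c₁ = qbinNat q k (h + suc i) H
      D = qbinNat q k n H
      T = (q ^ k) ^ H
      wYA≡X : w ℚ.* YA ≡ X
      wYA≡X = trans (weightB-monomial (k * H + b) n (H + suc i) EA)
        (cong₂ (monomial n) (ℕP.+-comm 1 (H + suc i))
               (trans (cong (λ c → k * H + c + EA) b≡a+[b∸a]) (exponent k a (b ∸ a) h i n)))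
        where
        exponent : ∀ k a s h i n →
          k * suc h + (a + s) + ((suc h + suc i + n) * a + k * (suc h * suc h) + s * (suc h + suc i))
            ≡ (suc h + suc i + 1 + n) * a + k * (suc h * suc h) + k * suc h + s * (suc h + suc i + 1)
        exponent = ℕ-Ring.solve-∀
      wYB≡XT : w ℚ.* YB ≡ X ℚ.* T
      wYB≡XT = trans (weightB-monomial (k * H + b) n (H + i + 1) EB)
        (trans (cong₂ (monomial n) (sym (cong (_+ 1) (ℕP.+-suc H i)))
                               (trans (cong (λ c → k * H + c + EB) b≡a+[b∸a]) (exponent k a (b ∸ a) h i n)))
               (sym (monomial-qᵏ n (H + suc i + 1) E H)))
        where
        exponent : ∀ k a s h i n →
          k * suc h + (a + s) + ((suc h + i + 1 + n) * a + k * (suc h * suc h) + k * suc h + s * (suc h + i + 1))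
            ≡ (suc h + suc i + 1 + n) * a + k * (suc h * suc h) + k * suc h + s * (suc h + suc i + 1) + k * suc h
        exponent = ℕ-Ring.solve-∀
      shuffle : ∀ (x c₀ t c₁ d : ℚ) → x ℚ.* (c₀ ℚ.+ t ℚ.* c₁) ℚ.* d ≡ x ℚ.* (c₀ ℚ.* d ℚ.+ t ℚ.* (c₁ ℚ.* d))
      shuffle = solve-∀ ℚ-ring
      unshuffle : ∀ (w ya yb c₀ c₁ d : ℚ) →
        w ℚ.* (ya ℚ.* (c₀ ℚ.* d) ℚ.+ yb ℚ.* (c₁ ℚ.* d)) ≡ w ℚ.* (ya ℚ.* c₀ ℚ.* d ℚ.+ yb ℚ.* c₁ ℚ.* d)
      unshuffle = solve-∀ ℚ-ring

    termB′-zero : ∀ h n → termB′ (suc h) 0 n ≡ weightB (k * suc h + b) ℚ.* termA′ h 0 n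
    termB′-zero h n = rescale-* w X YA (qbinNat q k (H + 0) H) (qbinNat q k (h + 0) h) (qbinNat q k n H) wYA≡X
      (trans (diag H) (sym (diag h)))
      where
      H = suc h
      w = weightB (k * H + b)
      E = (H + 0 + 1 + n) * a + k * (H * H) + k * H + (b ∸ a) * (H + 0 + 1)
      EA = (H + 0 + n) * a + k * (H * H) + (b ∸ a) * (H + 0)
      X = monomial n (H + 0 + 1) E
      YA = monomial n (H + 0) EA
      diag : ∀ j → qbinNat q k (j + 0) j ≡ 1ℚ
      diag j = trans (cong (λ z → qbinNat q k z j) (ℕP.+-identityʳ j)) (qbinNat-diag k q≢1 q≢-1 j)
      wYA≡X : w ℚ.* YA ≡ X
      wYA≡X = trans (weightB-monomial (k * H + b) n (H + 0) EA)
        (cong₂ (monomial n) (ℕP.+-comm 1 (H + 0))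
               (trans (cong (λ c → k * H + c + EA) b≡a+[b∸a]) (exponent k a (b ∸ a) h n)))
        where
        exponent : ∀ k a s h n →
          k * suc h + (a + s) + ((suc h + 0 + n) * a + k * (suc h * suc h) + s * (suc h + 0))
            ≡ (suc h + 0 + 1 + n) * a + k * (suc h * suc h) + k * suc h + s * (suc h + 0 + 1)
        exponent = ℕ-Ring.solve-∀

    termB′₀-suc : ∀ i n → termB′ 0 (suc i) n ≡ weightB (k * 0 + b) ℚ.* termB′ 0 i n
    termB′₀-suc i n = rescale-* w X Y (qbinNat q k (suc i) 0) (qbinNat q k i 0) (qbinNat q k n 0) wY≡X
      (trans (qbinNat-zero k q≢1 q≢-1 (suc i)) (sym (qbinNat-zero k q≢1 q≢-1 i)))
      where
      w = weightB (k * 0 + b)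
      E = (suc i + 1 + n) * a + k * (0 * 0) + k * 0 + (b ∸ a) * (suc i + 1)
      EB = (i + 1 + n) * a + k * (0 * 0) + k * 0 + (b ∸ a) * (i + 1)
      X = monomial n (suc i + 1) E
      Y = monomial n (i + 1) EB
      wY≡X : w ℚ.* Y ≡ X
      wY≡X = trans (weightB-monomial (k * 0 + b) n (i + 1) EB)
        (cong (monomial n (suc i + 1)) (trans (cong (λ c → k * 0 + c + EB) b≡a+[b∸a]) (exponent k a (b ∸ a) i n)))
        where
        exponent : ∀ k a s i n →
          k * 0 + (a + s) + ((i + 1 + n) * a + k * (0 * 0) + k * 0 + s * (i + 1))
            ≡ (suc i + 1 + n) * a + k * (0 * 0) + k * 0 + s * (suc i + 1)
        exponent = ℕ-Ring.solve-∀

    termB′₀-zero : ∀ n → termB′ 0 0 n ≡ weightB (k * 0 + b) ℚ.* closed-a n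
    termB′₀-zero n = begin
      X ℚ.* qbinNat q k 0 0 ℚ.* qbinNat q k n 0 ≡⟨ cong₂ (λ c d → X ℚ.* c ℚ.* d)
                                                      (qbinNat-zero k q≢1 q≢-1 0) (qbinNat-zero k q≢1 q≢-1 n) ⟩
      X ℚ.* 1ℚ ℚ.* 1ℚ                           ≡⟨ trans (ℚP.*-identityʳ _) (ℚP.*-identityʳ X) ⟩
      X                                         ≡⟨ wY≡X ⟨
      w ℚ.* monomial n 0 (n * a)                ≡⟨ cong (λ z → w ℚ.* (z ℚ.* q ^ (n * a))) (ℚP.*-identityʳ (μ ^ n)) ⟩
      w ℚ.* closed-a n                          ∎
      where
      open ≡-Reasoning
      w = weightB (k * 0 + b)
      E = (1 + n) * a + k * (0 * 0) + k * 0 + (b ∸ a) * 1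
      X = monomial n 1 E
      wY≡X : w ℚ.* monomial n 0 (n * a) ≡ X
      wY≡X = trans (weightB-monomial (k * 0 + b) n 0 (n * a))
        (cong (monomial n 1) (trans (cong (λ c → k * 0 + c + n * a) b≡a+[b∸a]) (exponent k a (b ∸ a) n)))
        where
        exponent : ∀ k a s n → k * 0 + (a + s) + n * a ≡ (1 + n) * a + k * (0 * 0) + k * 0 + s * 1
        exponent = ℕ-Ring.solve-∀

    termA-step : ∀ m h i →
      termA (suc m) (suc h) i ≡ weightA (k * suc h + a) ℚ.* (termA m (suc h) i ℚ.+ termB m h i)
    termA-step m h i = ≤-cases {P = Step} (suc h + i) large small m
      where
      open ≡-Reasoning
      w = weightA (k * suc h + a)
      Step : ℕ → Set
      Step m = termA (suc m) (suc h) i ≡ w ℚ.* (termA m (suc h) i ℚ.+ termB m h i)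
      large : ∀ n → Step (suc h + i + n)
      large n = begin
        termA (suc (suc h + i + n)) (suc h) i ≡⟨ termA≡termA′ h i (suc n) (sym (ℕP.+-suc (suc h + i) n)) ⟩
        termA′ h i (suc n)                    ≡⟨ termA′-suc h i n ⟩
        w ℚ.* (termA′ h i n ℚ.+ termB′ h i n) ≡⟨ cong (w ℚ.*_) (cong₂ ℚ._+_ (termA≡termA′ h i n refl)
                                                    (termB≡termB′ h i n (cong (_+ n) (ℕP.+-comm 1 (h + i))))) ⟨
        w ℚ.* (termA (suc h + i + n) (suc h) i ℚ.+ termB (suc h + i + n) h i) ∎
      small : ∀ m → m < suc h + i → Step m
      small m m<j = begin
        termA (suc m) (suc h) i                 ≡⟨ termA-≡0 (suc m) (suc h) i (ℕP.≤-<-trans m<j (ℕP.m<m+n _ (s≤s z≤n))) ⟩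
        0ℚ                                      ≡⟨ ℚP.*-zeroʳ w ⟨
        w ℚ.* (0ℚ ℚ.+ 0ℚ)                       ≡⟨ cong (w ℚ.*_) (cong₂ ℚ._+_ (termA-≡0 m (suc h) i m<j+h) (termB-≡0 m h i m<j+h′)) ⟨
        w ℚ.* (termA m (suc h) i ℚ.+ termB m h i) ∎
        where
        m<j+h : m < suc h + i + suc h
        m<j+h = ℕP.<-≤-trans m<j (ℕP.m≤m+n _ _)
        m<j+h′ : m < h + i + 1 + h
        m<j+h′ = subst (λ j → m < j + h) (ℕP.+-comm 1 (h + i)) (ℕP.<-≤-trans m<j (ℕP.m≤m+n _ _))

    termB-step : ∀ m h i → termB (suc m) (suc h) (suc i)
      ≡ weightB (k * suc h + b) ℚ.* (termA m (suc h) (suc i) ℚ.+ termB m (suc h) i)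
    termB-step m h i = ≤-cases {P = Step} (H + i + 1) large small m
      where
      open ≡-Reasoning
      H = suc h
      w = weightB (k * H + b)
      Step : ℕ → Set
      Step m = termB (suc m) H (suc i) ≡ w ℚ.* (termA m H (suc i) ℚ.+ termB m H i)
      H+i+1≡H+[1+i] : H + i + 1 ≡ H + suc i
      H+i+1≡H+[1+i] = trans (ℕP.+-assoc H i 1) (cong (λ x → H + x) (ℕP.+-comm i 1))
      shift : ∀ h i → suc (suc h + i + 1) ≡ suc h + suc i + 1
      shift = ℕ-Ring.solve-∀
      large : ∀ n → Step (H + i + 1 + n)
      large n = begin
        termB (suc (H + i + 1 + n)) H (suc i)
          ≡⟨ termB≡termB′ H (suc i) n (cong (_+ n) (shift h i)) ⟩
        termB′ H (suc i) n
          ≡⟨ termB′-suc h i n ⟩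
        w ℚ.* (termA′ h (suc i) n ℚ.+ termB′ H i n)
          ≡⟨ cong (w ℚ.*_) (cong₂ ℚ._+_ (termA≡termA′ h (suc i) n (cong (_+ n) H+i+1≡H+[1+i]))
                                         (termB≡termB′ H i n refl)) ⟨
        w ℚ.* (termA (H + i + 1 + n) H (suc i) ℚ.+ termB (H + i + 1 + n) H i) ∎
      small : ∀ m → m < H + i + 1 → Step m
      small m m<j = begin
        termB (suc m) H (suc i)              ≡⟨ termB-≡0 (suc m) H (suc i)
                                                  (≤-+-≡ (s≤s m<j) H (cong (_+ H) (shift h i))) ⟩
        0ℚ                                   ≡⟨ ℚP.*-zeroʳ w ⟨
        w ℚ.* (0ℚ ℚ.+ 0ℚ)                    ≡⟨ cong (w ℚ.*_) (cong₂ ℚ._+_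
                                                  (termA-≡0 m H (suc i) (≤-+-≡ m<j H (cong (_+ H) H+i+1≡H+[1+i])))
                                                  (termB-≡0 m H i (≤-+-≡ m<j H refl))) ⟨
        w ℚ.* (termA m H (suc i) ℚ.+ termB m H i) ∎

    termB-step-zero : ∀ m h → termB (suc m) (suc h) 0 ≡ weightB (k * suc h + b) ℚ.* termA m (suc h) 0
    termB-step-zero m h = ≤-cases {P = Step} H large small m
      where
      open ≡-Reasoning
      H = suc h
      w = weightB (k * H + b)
      Step : ℕ → Set
      Step m = termB (suc m) H 0 ≡ w ℚ.* termA m H 0
      shift : ∀ h n → suc (suc h + n) ≡ suc h + 0 + 1 + n
      shift = ℕ-Ring.solve-∀
      large : ∀ n → Step (H + n)
      large n = begin
        termB (suc (H + n)) H 0 ≡⟨ termB≡termB′ H 0 n (shift h n) ⟩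
        termB′ H 0 n            ≡⟨ termB′-zero h n ⟩
        w ℚ.* termA′ h 0 n      ≡⟨ cong (w ℚ.*_) (termA≡termA′ h 0 n (cong (_+ n) (sym (ℕP.+-identityʳ H)))) ⟨
        w ℚ.* termA (H + n) H 0 ∎
      small : ∀ m → m < H → Step m
      small m m<H = begin
        termB (suc m) H 0 ≡⟨ termB-≡0 (suc m) H 0 (≤-+-≡ (s≤s m<H) H (shift h H)) ⟩
        0ℚ                ≡⟨ ℚP.*-zeroʳ w ⟨
        w ℚ.* 0ℚ          ≡⟨ cong (w ℚ.*_) (termA-≡0 m H 0 (≤-+-≡ m<H H (cong (_+ H) (sym (ℕP.+-identityʳ H))))) ⟨
        w ℚ.* termA m H 0 ∎

    termB₀-step : ∀ m i → termB (suc m) 0 (suc i) ≡ weightB (k * 0 + b) ℚ.* termB m 0 i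
    termB₀-step m i = ≤-cases {P = Step} (i + 1) large small m
      where
      open ≡-Reasoning
      w = weightB (k * 0 + b)
      Step : ℕ → Set
      Step m = termB (suc m) 0 (suc i) ≡ w ℚ.* termB m 0 i
      large : ∀ n → Step (i + 1 + n)
      large n = begin
        termB (suc (i + 1 + n)) 0 (suc i) ≡⟨ termB≡termB′ 0 (suc i) n refl ⟩
        termB′ 0 (suc i) n                ≡⟨ termB′₀-suc i n ⟩
        w ℚ.* termB′ 0 i n                ≡⟨ cong (w ℚ.*_) (termB≡termB′ 0 i n refl) ⟨
        w ℚ.* termB (i + 1 + n) 0 i       ∎
      small : ∀ m → m < i + 1 → Step m
      small m m<j = begin
        termB (suc m) 0 (suc i) ≡⟨ termB-≡0 (suc m) 0 (suc i) (≤-+-≡ (s≤s m<j) 0 refl) ⟩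
        0ℚ                      ≡⟨ ℚP.*-zeroʳ w ⟨
        w ℚ.* 0ℚ                ≡⟨ cong (w ℚ.*_) (termB-≡0 m 0 i (≤-+-≡ m<j 0 refl)) ⟨
        w ℚ.* termB m 0 i       ∎

    termB₀-step-zero : ∀ m → termB (suc m) 0 0 ≡ weightB (k * 0 + b) ℚ.* closed-a m
    termB₀-step-zero m = trans (termB≡termB′ 0 0 m refl) (termB′₀-zero m)

    closedA-step : ∀ m h →
      closedA (suc m) (suc h) ≡ weightA (k * suc h + a) ℚ.* (closedA m (suc h) ℚ.+ closedB m h)
    closedA-step m h = begin
      sumℚ (suc (suc m)) (termA (suc m) H)
        ≡⟨ sumℚ-last-≡0 (suc m) (termA (suc m) H) (termA-≡0 (suc m) H (suc m) (≤-+-≡ (ℕP.m<n+m (suc m) (s≤s z≤n)) H refl)) ⟩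
      sumℚ (suc m) (termA (suc m) H)
        ≡⟨ sumℚ-cong (suc m) (termA-step m h) ⟩
      sumℚ (suc m) (λ i → w ℚ.* (termA m H i ℚ.+ termB m h i))
        ≡⟨ sumℚ-*ˡ (suc m) w _ ⟩
      w ℚ.* sumℚ (suc m) (λ i → termA m H i ℚ.+ termB m h i)
        ≡⟨ cong (w ℚ.*_) (sumℚ-+ (suc m) (termA m H) (termB m h)) ⟩
      w ℚ.* (closedA m H ℚ.+ closedB m h) ∎
      where
      open ≡-Reasoning
      H = suc h
      w = weightA (k * H + a)

    closedB-step : ∀ m h →
      closedB (suc m) (suc h) ≡ weightB (k * suc h + b) ℚ.* (closedB m (suc h) ℚ.+ closedA m (suc h))
    closedB-step m h = begin
      sumℚ (suc (suc m)) (termB (suc m) H)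
        ≡⟨ sumℚ-suc (suc m) (termB (suc m) H) ⟩
      termB (suc m) H 0 ℚ.+ sumℚ (suc m) (λ i → termB (suc m) H (suc i))
        ≡⟨ cong₂ ℚ._+_ (termB-step-zero m h) (sumℚ-cong (suc m) (termB-step m h)) ⟩
      w ℚ.* A₀ ℚ.+ sumℚ (suc m) (λ i → w ℚ.* (termA m H (suc i) ℚ.+ termB m H i))
        ≡⟨ cong (w ℚ.* A₀ ℚ.+_) (trans (sumℚ-*ˡ (suc m) w _) (cong (w ℚ.*_) (sumℚ-+ (suc m) A₊ (termB m H)))) ⟩
      w ℚ.* A₀ ℚ.+ w ℚ.* (sumℚ (suc m) A₊ ℚ.+ closedB m H)
        ≡⟨ cong (λ z → w ℚ.* A₀ ℚ.+ w ℚ.* (z ℚ.+ closedB m H))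
                (sumℚ-last-≡0 m A₊ (termA-≡0 m H (suc m) (≤-+-≡ (ℕP.m≤n+m (suc m) H) H refl))) ⟩
      w ℚ.* A₀ ℚ.+ w ℚ.* (sumℚ m A₊ ℚ.+ closedB m H)
        ≡⟨ regroup w A₀ (sumℚ m A₊) (closedB m H) ⟩
      w ℚ.* (closedB m H ℚ.+ (A₀ ℚ.+ sumℚ m A₊))
        ≡⟨ cong (λ z → w ℚ.* (closedB m H ℚ.+ z)) (sumℚ-suc m (termA m H)) ⟨
      w ℚ.* (closedB m H ℚ.+ closedA m H) ∎
      where
      open ≡-Reasoning
      H = suc h
      w = weightB (k * H + b)
      A₀ = termA m H 0
      A₊ : ℕ → ℚ
      A₊ i = termA m H (suc i)
      regroup : ∀ (w x y z : ℚ) → w ℚ.* x ℚ.+ w ℚ.* (y ℚ.+ z) ≡ w ℚ.* (z ℚ.+ (x ℚ.+ y))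
      regroup = solve-∀ ℚ-ring

    closedB₀-step : ∀ m → closedB (suc m) 0 ≡ weightB (k * 0 + b) ℚ.* (closedB m 0 ℚ.+ closed-a m)
    closedB₀-step m = begin
      sumℚ (suc (suc m)) (termB (suc m) 0)
        ≡⟨ sumℚ-suc (suc m) (termB (suc m) 0) ⟩
      termB (suc m) 0 0 ℚ.+ sumℚ (suc m) (λ i → termB (suc m) 0 (suc i))
        ≡⟨ cong₂ ℚ._+_ (termB₀-step-zero m) (trans (sumℚ-cong (suc m) (termB₀-step m)) (sumℚ-*ˡ (suc m) w (termB m 0))) ⟩
      w ℚ.* closed-a m ℚ.+ w ℚ.* closedB m 0
        ≡⟨ regroup w (closed-a m) (closedB m 0) ⟩
      w ℚ.* (closedB m 0 ℚ.+ closed-a m) ∎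
      where
      open ≡-Reasoning
      w = weightB (k * 0 + b)
      regroup : ∀ (w x y : ℚ) → w ℚ.* x ℚ.+ w ℚ.* y ≡ w ℚ.* (y ℚ.+ x)
      regroup = solve-∀ ℚ-ring

    closedA-zero : ∀ h → closedA 0 (suc h) ≡ 0ℚ
    closedA-zero h = cong (0ℚ ℚ.+_) (termA-≡0 0 (suc h) 0 (s≤s z≤n))

    closedB-zero : ∀ h → closedB 0 h ≡ 0ℚ
    closedB-zero h = cong (0ℚ ℚ.+_) (termB-≡0 0 h 0 (ℕP.≤-trans (ℕP.m≤n+m 1 (h + 0)) (ℕP.m≤m+n (h + 0 + 1) h)))

    closedA-one : ∀ h → closedA 1 (suc h) ≡ 0ℚ
    closedA-one h = begin
      closedA 1 (suc h)                           ≡⟨ closedA-step 0 h ⟩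
      w ℚ.* (closedA 0 (suc h) ℚ.+ closedB 0 h)   ≡⟨ cong (w ℚ.*_) (cong₂ ℚ._+_ (closedA-zero h) (closedB-zero h)) ⟩
      w ℚ.* 0ℚ                                    ≡⟨ ℚP.*-zeroʳ w ⟩
      0ℚ                                          ∎
      where
      open ≡-Reasoning
      w = weightA (k * suc h + a)

    closedB-one : ∀ h → closedB 1 (suc h) ≡ 0ℚ
    closedB-one h = begin
      closedB 1 (suc h)                                 ≡⟨ closedB-step 0 h ⟩
      w ℚ.* (closedB 0 (suc h) ℚ.+ closedA 0 (suc h))   ≡⟨ cong (w ℚ.*_) (cong₂ ℚ._+_ (closedB-zero (suc h)) (closedA-zero h)) ⟩
      w ℚ.* 0ℚ                                          ≡⟨ ℚP.*-zeroʳ w ⟩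
      0ℚ                                                ∎
      where
      open ≡-Reasoning
      w = weightB (k * suc h + b)

    closedB₀-one : closedB 1 0 ≡ weightB (k * 0 + b)
    closedB₀-one = begin
      closedB 1 0                        ≡⟨ closedB₀-step 0 ⟩
      w ℚ.* (closedB 0 0 ℚ.+ closed-a 0)    ≡⟨ cong (λ z → w ℚ.* (z ℚ.+ closed-a 0)) (closedB-zero 0) ⟩
      w ℚ.* (0ℚ ℚ.+ 1ℚ ℚ.* 1ℚ)           ≡⟨ ℚP.*-identityʳ w ⟩
      w                                  ∎
      where
      open ≡-Reasoning
      w = weightB (k * 0 + b)

    weightA-closed-a : ∀ m → weightA a ℚ.* closed-a m ≡ closed-a (suc m)
    weightA-closed-a m = begin
      μ ℚ.* q ^ a ℚ.* (μ ^ m ℚ.* q ^ (m * a)) ≡⟨ regroup μ (q ^ a) (μ ^ m) (q ^ (m * a)) ⟩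
      μ ℚ.* μ ^ m ℚ.* (q ^ a ℚ.* q ^ (m * a)) ≡⟨ cong (μ ℚ.* μ ^ m ℚ.*_) (^-+ q a (m * a)) ⟨
      μ ℚ.* μ ^ m ℚ.* q ^ (a + m * a)         ∎
      where
      open ≡-Reasoning
      regroup : ∀ (m qa mm qm : ℚ) → m ℚ.* qa ℚ.* (mm ℚ.* qm) ≡ m ℚ.* mm ℚ.* (qa ℚ.* qm)
      regroup = solve-∀ ℚ-ring

    module _ {L : ℕ} {G : ℕ → ℕ → ℚ} (rec : Recurrences L G) (a<b : a < b) (b≤k : b ≤ k) where

      open Recurrences rec

      private
        k*0+ : ∀ c → k * 0 + c ≡ c
        k*0+ c = cong (_+ c) (ℕP.*-zeroʳ k)

        A≤B : ∀ h → k * h + a ≤ k * h + b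
        A≤B h = ℕP.+-monoʳ-≤ (k * h) (ℕP.<⇒≤ a<b)

        B≤A : ∀ h → k * h + b ≤ k * suc h + a
        B≤A h = class-≤ h (ℕP.≤-trans b≤k (ℕP.m≤m+n k a))

      closedForms-one : ClosedFormsHold L G 0
      closedForms-one = A₀ , A , B
        where
        A₀ : a ≤ L → G 1 a ≡ closed-a 1
        A₀ a≤L = trans (one-a a≤L) (cong₂ ℚ._*_ (sym (ℚP.*-identityʳ μ)) (cong (q ^_) (sym (ℕP.+-identityʳ a))))
        A : ∀ h → k * suc h + a ≤ L → G 1 (k * suc h + a) ≡ closedA 1 (suc h)
        A h ≤L = trans (one-A h ≤L) (sym (closedA-one h))
        B : ∀ h → k * h + b ≤ L → G 1 (k * h + b) ≡ closedB 1 h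
        B zero    ≤L = begin
          G 1 (k * 0 + b)     ≡⟨ cong (G 1) (k*0+ b) ⟩
          G 1 b               ≡⟨ one-b (subst (_≤ L) (k*0+ b) ≤L) ⟩
          weightB b           ≡⟨ cong weightB (k*0+ b) ⟨
          weightB (k * 0 + b) ≡⟨ closedB₀-one ⟨
          closedB 1 0         ∎
          where open ≡-Reasoning
        B (suc h) ≤L = trans (one-B h ≤L) (sym (closedB-one h))

      closedForms-suc : ∀ {m} → ClosedFormsHold L G m → ClosedFormsHold L G (suc m)
      closedForms-suc {m} (ihA₀ , ihA , ihB) = A₀ , A , B
        where
        A₀ : a ≤ L → G (2 + m) a ≡ closed-a (2 + m)
        A₀ a≤L = trans (step-a m a≤L) (trans (cong (weightA a ℚ.*_) (ihA₀ a≤L)) (weightA-closed-a (suc m)))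
        A : ∀ h → k * suc h + a ≤ L → G (2 + m) (k * suc h + a) ≡ closedA (2 + m) (suc h)
        A h ≤L = trans (step-A m h ≤L)
          (trans (cong (weightA (k * suc h + a) ℚ.*_) (cong₂ ℚ._+_ (ihA h ≤L) (ihB h (ℕP.≤-trans (B≤A h) ≤L))))
                 (sym (closedA-step (suc m) h)))
        B : ∀ h → k * h + b ≤ L → G (2 + m) (k * h + b) ≡ closedB (2 + m) h
        B zero    ≤L = trans (step-B m 0 ≤L)
          (trans (cong (weightB (k * 0 + b) ℚ.*_)
                       (cong₂ ℚ._+_ (ihB 0 ≤L) (trans (cong (G (suc m)) (k*0+ a))
                                                       (ihA₀ (subst (_≤ L) (k*0+ a) (ℕP.≤-trans (A≤B 0) ≤L))))))
                 (sym (closedB₀-step (suc m))))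
        B (suc h) ≤L = trans (step-B m (suc h) ≤L)
          (trans (cong (weightB (k * suc h + b) ℚ.*_)
                       (cong₂ ℚ._+_ (ihB (suc h) ≤L) (ihA h (ℕP.≤-trans (A≤B (suc h)) ≤L))))
                 (sym (closedB-step (suc m) h)))

      recurrences⇒closedForms : ∀ m → ClosedFormsHold L G m
      recurrences⇒closedForms zero    = closedForms-one
      recurrences⇒closedForms (suc m) = closedForms-suc (recurrences⇒closedForms m)

  -- The partition sums satisfy the recurrences

  module _ (1≤a : 1 ≤ a) (a<b : a < b) (b≤k : b ≤ k) where

    a<k : a < k
    a<k = ℕP.<-≤-trans a<b b≤k

    %-class : ∀ d c → (k * d + c) % k ≡ c % k
    %-class d c = trans (cong (_% k) (trans (ℕP.+-comm (k * d) c) (cong (λ x → c + x) (ℕP.*-comm k d)))) ([m+kn]%n≡m%n c d k)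

    a%k≢b%k : a % k ≢ b % k
    a%k≢b%k a%k≡b%k with ℕP.m≤n⇒m<n∨m≡n b≤k
    ... | inj₁ b<k = ℕP.<-irrefl (trans (sym (m<n⇒m%n≡m a<k)) (trans a%k≡b%k (m<n⇒m%n≡m b<k))) a<b
    ... | inj₂ b≡k = ℕP.<-irrefl (sym (trans (sym (m<n⇒m%n≡m a<k)) (trans a%k≡b%k (trans (cong (_% k) b≡k) (n%n≡0 k))))) 1≤a

    congB-self : ∀ d c → congB k a b (k * d + c) c ≡ true
    congB-self d c = dec-true ((k * d + c) % k ℕ.≟ c % k) (%-class d c)

    congB-a-b : ∀ d → congB k a b (k * d + a) b ≡ false
    congB-a-b d = dec-false ((k * d + a) % k ℕ.≟ b % k) (λ eq → a%k≢b%k (trans (sym (%-class d a)) eq))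

    congB-b-a : ∀ d → congB k a b (k * d + b) a ≡ false
    congB-b-a d = dec-false ((k * d + b) % k ℕ.≟ a % k) (λ eq → a%k≢b%k (sym (trans (sym (%-class d b)) eq)))

    mod-class : ∀ {y c} → c ≤ k → 1 ≤ y → y % k ≡ c % k → ∃ λ d → y ≡ k * d + c
    mod-class {y} {c} c≤k 1≤y y%k≡c%k with ℕP.m≤n⇒m<n∨m≡n c≤k
    ... | inj₁ c<k = y / k , (begin
      y                 ≡⟨ m≡m%n+[m/n]*n y k ⟩
      y % k + y / k * k ≡⟨ cong₂ _+_ (trans y%k≡c%k (m<n⇒m%n≡m c<k)) (ℕP.*-comm (y / k) k) ⟩
      c + k * (y / k)   ≡⟨ ℕP.+-comm c (k * (y / k)) ⟩
      k * (y / k) + c   ∎)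
      where open ≡-Reasoning
    ... | inj₂ c≡k with y / k in y/k≡
    ...   | zero  = ⊥-elim (ℕP.<-irrefl (sym y≡0) 1≤y)
      where
      y≡0 : y ≡ 0
      y≡0 = trans (m≡m%n+[m/n]*n y k) (cong₂ _+_ (trans y%k≡c%k (trans (cong (_% k) c≡k) (n%n≡0 k))) (cong (_* k) y/k≡))
    ...   | suc d = d , (begin
      y                 ≡⟨ m≡m%n+[m/n]*n y k ⟩
      y % k + y / k * k ≡⟨ cong₂ _+_ (trans y%k≡c%k (trans (cong (_% k) c≡k) (n%n≡0 k))) (cong (_* k) y/k≡) ⟩
      k + d * k         ≡⟨ trans (ℕP.+-comm k (d * k)) (cong₂ _+_ (ℕP.*-comm d k) (sym c≡k)) ⟩
      k * d + c         ∎)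
      where open ≡-Reasoning

    classes : ∀ y → admissible y ≡ true → a ≤ y → ∃ λ d → y ≡ k * d + a ⊎ y ≡ k * d + b
    classes y adm a≤y with congB k a b y a in y≡a
    ... | true  = map₂ inj₁ (mod-class (ℕP.<⇒≤ a<k) (ℕP.≤-trans 1≤a a≤y) (does⇒ (y % k ℕ.≟ a % k) y≡a))
    ... | false = map₂ inj₂ (mod-class b≤k (ℕP.≤-trans 1≤a a≤y) (does⇒ (y % k ℕ.≟ b % k) adm))

    class-gap : ∀ {c d e} → d < e → k * d + c + k ≤ k * e + c
    class-gap {c} {d} {e} d<e = begin
      k * d + c + k ≡⟨ next-multiple d c ⟩
      k * suc d + c ≤⟨ ℕP.+-monoˡ-≤ c (ℕP.*-monoʳ-≤ k d<e) ⟩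
      k * e + c     ∎
      where open ℕP.≤-Reasoning

    window-unique : ∀ {l c d e} → Window l (k * d + c) → Window l (k * e + c) → d ≡ e
    window-unique (≤l₁ , l<₁) (≤l₂ , l<₂) with ℕP.<-cmp _ _
    ... | tri≈ _ d≡e _ = d≡e
    ... | tri< d<e _ _ = ⊥-elim (ℕP.<-irrefl refl (ℕP.<-≤-trans l<₁ (ℕP.≤-trans (class-gap d<e) ≤l₂)))
    ... | tri> _ _ e<d = ⊥-elim (ℕP.<-irrefl refl (ℕP.<-≤-trans l<₂ (ℕP.≤-trans (class-gap e<d) ≤l₁)))

    predecessors : ∀ {l d₁ d₂} → Window l (k * d₁ + a) → Window l (k * d₂ + b) →
      ∀ y → admissible y ≡ true → a ≤ y → Window l y → y ≡ k * d₁ + a ⊎ y ≡ k * d₂ + b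
    predecessors w₁ w₂ y adm a≤y wy with classes y adm a≤y
    ... | d , inj₁ refl = inj₁ (cong (λ d → k * d + a) (window-unique wy w₁))
    ... | d , inj₂ refl = inj₂ (cong (λ d → k * d + b) (window-unique wy w₂))

    window-true : ∀ {l y} → Window l y → window l y ≡ true
    window-true {l} {y} (y≤l , l<y+k) = cong₂ _∧_ (dec-true (y ℕ.≤? l) y≤l) (dec-true (l ℕ.<? y + k) l<y+k)

    window⇒ : ∀ {l y} → window l y ≡ true → Window l y
    window⇒ {l} {y} w = does⇒ (y ℕ.≤? l) (BoolP.∧-conicalˡ _ _ w) , does⇒ (l ℕ.<? y + k) (BoolP.∧-conicalʳ _ _ w)

    chain-lower-bound : ∀ y ys → chainOK k a b (y ∷ ys) ≡ true → a ≤ y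
    chain-lower-bound y [] c with ∨-true _ _ c
    ... | inj₁ y≡a = ℕP.≤-reflexive (sym (does⇒ (y ℕ.≟ a) y≡a))
    ... | inj₂ y≡b = ℕP.<⇒≤ (subst (a <_) (sym (does⇒ (y ℕ.≟ b) y≡b)) a<b)
    chain-lower-bound y (z ∷ zs) c = ℕP.≤-trans (chain-lower-bound z zs rest) (does⇒ (z ℕ.≤? y) z≤y)
      where
      z≤y = BoolP.∧-conicalˡ _ _ c
      rest = BoolP.∧-conicalʳ (does (y ℕ.<? z + k)) _ (BoolP.∧-conicalʳ (does (z ℕ.≤? y)) _ c)

    valid⇒admissible : ∀ y ys → valid (y ∷ ys) ≡ true → admissible y ≡ true
    valid⇒admissible y ys v = BoolP.∧-conicalˡ _ _ (BoolP.∧-conicalˡ _ _ v)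

    valid⇒a≤ : ∀ y ys → valid (y ∷ ys) ≡ true → a ≤ y
    valid⇒a≤ y ys v = chain-lower-bound y ys (BoolP.∧-conicalʳ _ _ v)

    contrib-head : ∀ c y ys → contrib c (y ∷ ys) ≡ (if valid (y ∷ ys) ∧ does (y ℕ.≟ c) then wt (y ∷ ys) else 0ℚ)
    contrib-head c y ys = cong (λ t → if t then wt (y ∷ ys) else 0ℚ)
      (sym (BoolP.∧-assoc (partsOK k a b (y ∷ ys)) (chainOK k a b (y ∷ ys)) (does (y ℕ.≟ c))))

    contrib-extend : ∀ l y ys → admissible l ≡ true →
      contrib l (l ∷ y ∷ ys) ≡ (if valid (y ∷ ys) ∧ window l y then wt (l ∷ y ∷ ys) else 0ℚ)
    contrib-extend l y ys adm = cong (λ t → if t then wt (l ∷ y ∷ ys) else 0ℚ)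
      (trans (cong₂ (λ x e → (x ∧ P) ∧ ((W₁ ∧ (W₂ ∧ C)) ∧ e)) adm (dec-true (l ℕ.≟ l) refl)) (shuffle P W₁ W₂ C))
      where
      P = partsOK k a b (y ∷ ys)
      C = chainOK k a b (y ∷ ys)
      W₁ = does (y ℕ.≤? l)
      W₂ = does (l ℕ.<? y + k)
      shuffle : ∀ p w₁ w₂ c → p ∧ ((w₁ ∧ (w₂ ∧ c)) ∧ true) ≡ (p ∧ c) ∧ (w₁ ∧ w₂)
      shuffle p true  true  c = trans (cong (p ∧_) (BoolP.∧-identityʳ c)) (sym (BoolP.∧-identityʳ (p ∧ c)))
      shuffle p true  false c = trans (BoolP.∧-zeroʳ p) (sym (BoolP.∧-zeroʳ (p ∧ c)))
      shuffle p false w₂    c = trans (BoolP.∧-zeroʳ p) (sym (BoolP.∧-zeroʳ (p ∧ c)))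

    contrib-≢ : ∀ l x xs → x ≢ l → contrib l (x ∷ xs) ≡ 0ℚ
    contrib-≢ l x xs x≢l = trans (contrib-head l x xs) (cong (λ t → if t then wt (x ∷ xs) else 0ℚ)
      (trans (cong (valid (x ∷ xs) ∧_) (dec-false (x ℕ.≟ l) x≢l)) (BoolP.∧-zeroʳ _)))

    contrib-zero : ∀ xs → contrib 0 xs ≡ 0ℚ
    contrib-zero []           = refl
    contrib-zero (suc y ∷ ys) = contrib-≢ 0 (suc y) ys (λ ())
    contrib-zero (zero ∷ ys)  = trans (contrib-head 0 0 ys) (cong (λ t → if t then wt (0 ∷ ys) else 0ℚ) invalid)
      where
      invalid : valid (0 ∷ ys) ∧ true ≡ false
      invalid with valid (0 ∷ ys) in v
      ... | false = refl
      ... | true with () ← ℕP.≤-trans 1≤a (valid⇒a≤ 0 ys v)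

    contrib-single : ∀ l → admissible l ≡ true → does (l ℕ.≟ a) ∨ does (l ℕ.≟ b) ≡ true →
                     contrib l (l ∷ []) ≡ wt (l ∷ [])
    contrib-single l adm end = cong (λ t → if t then wt (l ∷ []) else 0ℚ)
      (cong₂ (λ x e → (x ∧ true) ∧ e) adm (trans (cong (_∧ does (l ℕ.≟ l)) end) (dec-true (l ℕ.≟ l) refl)))

    contrib-single-≡0 : ∀ l → does (l ℕ.≟ a) ∨ does (l ℕ.≟ b) ≡ false → contrib l (l ∷ []) ≡ 0ℚ
    contrib-single-≡0 l end = cong (λ t → if t then wt (l ∷ []) else 0ℚ)
      (trans (cong (λ e → (admissible l ∧ true) ∧ (e ∧ does (l ℕ.≟ l))) end) (BoolP.∧-zeroʳ _))

    wt-cons-a : ∀ l zs → congB k a b l a ≡ true → congB k a b l b ≡ false → wt (l ∷ zs) ≡ weightA l ℚ.* wt zs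
    wt-cons-a l zs l≡a l≢b = begin
      μ ^ (ind (congB k a b l a) + CA) ℚ.* ν ^ (ind (congB k a b l b) + CB) ℚ.* q ^ (l + S)
        ≡⟨ cong₂ (λ x y → μ ^ (ind x + CA) ℚ.* ν ^ (ind y + CB) ℚ.* q ^ (l + S)) l≡a l≢b ⟩
      μ ℚ.* μ ^ CA ℚ.* ν ^ CB ℚ.* q ^ (l + S)
        ≡⟨ cong (μ ℚ.* μ ^ CA ℚ.* ν ^ CB ℚ.*_) (^-+ q l S) ⟩
      μ ℚ.* μ ^ CA ℚ.* ν ^ CB ℚ.* (q ^ l ℚ.* q ^ S)
        ≡⟨ regroup μ (μ ^ CA) (ν ^ CB) (q ^ l) (q ^ S) ⟩
      μ ℚ.* q ^ l ℚ.* (μ ^ CA ℚ.* ν ^ CB ℚ.* q ^ S) ∎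
      where
      open ≡-Reasoning
      ind : Bool → ℕ
      ind t = if t then 1 else 0
      CA = countCong k a b a zs
      CB = countCong k a b b zs
      S = size k a b zs
      regroup : ∀ (m ma nb ql qs : ℚ) → m ℚ.* ma ℚ.* nb ℚ.* (ql ℚ.* qs) ≡ m ℚ.* ql ℚ.* (ma ℚ.* nb ℚ.* qs)
      regroup = solve-∀ ℚ-ring

    wt-cons-b : ∀ l zs → congB k a b l a ≡ false → congB k a b l b ≡ true → wt (l ∷ zs) ≡ weightB l ℚ.* wt zs
    wt-cons-b l zs l≢a l≡b = begin
      μ ^ (ind (congB k a b l a) + CA) ℚ.* ν ^ (ind (congB k a b l b) + CB) ℚ.* q ^ (l + S)
        ≡⟨ cong₂ (λ x y → μ ^ (ind x + CA) ℚ.* ν ^ (ind y + CB) ℚ.* q ^ (l + S)) l≢a l≡b ⟩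
      μ ^ CA ℚ.* (ν ℚ.* ν ^ CB) ℚ.* q ^ (l + S)
        ≡⟨ cong (μ ^ CA ℚ.* (ν ℚ.* ν ^ CB) ℚ.*_) (^-+ q l S) ⟩
      μ ^ CA ℚ.* (ν ℚ.* ν ^ CB) ℚ.* (q ^ l ℚ.* q ^ S)
        ≡⟨ regroup ν (μ ^ CA) (ν ^ CB) (q ^ l) (q ^ S) ⟩
      ν ℚ.* q ^ l ℚ.* (μ ^ CA ℚ.* ν ^ CB ℚ.* q ^ S) ∎
      where
      open ≡-Reasoning
      ind : Bool → ℕ
      ind t = if t then 1 else 0
      CA = countCong k a b a zs
      CB = countCong k a b b zs
      S = size k a b zs
      regroup : ∀ (n ma nb ql qs : ℚ) → ma ℚ.* (n ℚ.* nb) ℚ.* (ql ℚ.* qs) ≡ n ℚ.* ql ℚ.* (ma ℚ.* nb ℚ.* qs)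
      regroup = solve-∀ ℚ-ring

    contrib-step : ∀ l c₁ c₂ w → admissible l ≡ true → (∀ zs → wt (l ∷ zs) ≡ w ℚ.* wt zs) →
      c₁ ≢ c₂ → Window l c₁ → Window l c₂ →
      (∀ y → admissible y ≡ true → a ≤ y → Window l y → y ≡ c₁ ⊎ y ≡ c₂) →
      ∀ y ys → contrib l (l ∷ y ∷ ys) ≡ w ℚ.* (contrib c₁ (y ∷ ys) ℚ.+ contrib c₂ (y ∷ ys))
    contrib-step l c₁ c₂ w adm wt-l c₁≢c₂ w₁ w₂ predecessor y ys = begin
      contrib l (l ∷ y ∷ ys)
        ≡⟨ contrib-extend l y ys adm ⟩
      (if V ∧ window l y then wt (l ∷ y ∷ ys) else 0ℚ)
        ≡⟨ cong (λ x → if V ∧ window l y then x else 0ℚ) (wt-l (y ∷ ys)) ⟩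
      (if V ∧ window l y then w ℚ.* wt (y ∷ ys) else 0ℚ)
        ≡⟨ if-*ˡ (V ∧ window l y) w (wt (y ∷ ys)) ⟩
      w ℚ.* (if V ∧ window l y then wt (y ∷ ys) else 0ℚ)
        ≡⟨ cong (w ℚ.*_) (if-∨ V (wt (y ∷ ys)) window≡ exclusive) ⟩
      w ℚ.* ((if V ∧ does (y ℕ.≟ c₁) then wt (y ∷ ys) else 0ℚ) ℚ.+ (if V ∧ does (y ℕ.≟ c₂) then wt (y ∷ ys) else 0ℚ))
        ≡⟨ cong (w ℚ.*_) (cong₂ ℚ._+_ (contrib-head c₁ y ys) (contrib-head c₂ y ys)) ⟨
      w ℚ.* (contrib c₁ (y ∷ ys) ℚ.+ contrib c₂ (y ∷ ys)) ∎
      where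
      open ≡-Reasoning
      V = valid (y ∷ ys)
      window≡ : V ≡ true → window l y ≡ does (y ℕ.≟ c₁) ∨ does (y ℕ.≟ c₂)
      window≡ v with y ℕ.≟ c₁ | y ℕ.≟ c₂
      ... | yes y≡c₁ | _        = trans (window-true (subst (Window l) (sym y≡c₁) w₁))
                                        (sym (cong (_∨ does (y ℕ.≟ c₂)) (dec-true (y ℕ.≟ c₁) y≡c₁)))
      ... | no y≢c₁  | yes y≡c₂ = trans (window-true (subst (Window l) (sym y≡c₂) w₂))
                                        (sym (cong₂ _∨_ (dec-false (y ℕ.≟ c₁) y≢c₁) (dec-true (y ℕ.≟ c₂) y≡c₂)))
      ... | no y≢c₁  | no y≢c₂  = trans outside (sym (cong₂ _∨_ (dec-false (y ℕ.≟ c₁) y≢c₁) (dec-false (y ℕ.≟ c₂) y≢c₂)))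
        where
        outside : window l y ≡ false
        outside with window l y in wy
        ... | false = refl
        ... | true  = ⊥-elim ([ y≢c₁ , y≢c₂ ] (predecessor y (valid⇒admissible y ys v) (valid⇒a≤ y ys v) (window⇒ wy)))
      exclusive : does (y ℕ.≟ c₁) ≡ true → does (y ℕ.≟ c₂) ≡ false
      exclusive y≡c₁ = dec-false (y ℕ.≟ c₂) (λ y≡c₂ → c₁≢c₂ (trans (sym (does⇒ (y ℕ.≟ c₁) y≡c₁)) y≡c₂))

    partitionSum-head : ∀ L m l → l ≤ L → partitionSum L (suc m) l ≡ sumL (λ xs → contrib l (l ∷ xs)) (allLists m L)
    partitionSum-head L m l l≤L = trans (sumL-allLists-suc m L (contrib l)) (sumL-cong (allLists m L) λ xs →
      sumL-singletons-at L l (λ ys → contrib l (ys ++ xs)) l≤L (λ x x≢l → contrib-≢ l x xs x≢l))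

    partitionSum-one : ∀ L l → l ≤ L → partitionSum L 1 l ≡ contrib l (l ∷ [])
    partitionSum-one L l l≤L = trans (partitionSum-head L 0 l l≤L) (ℚP.+-identityʳ _)

    partitionSum-zero : ∀ L m → partitionSum L m 0 ≡ 0ℚ
    partitionSum-zero L m = trans (sumL-cong (allLists m L) contrib-zero) (sumL-0 (allLists m L))

    partitionSum-step : ∀ L m l c₁ c₂ w → l ≤ L →
      (∀ y ys → contrib l (l ∷ y ∷ ys) ≡ w ℚ.* (contrib c₁ (y ∷ ys) ℚ.+ contrib c₂ (y ∷ ys))) →
      partitionSum L (2 + m) l ≡ w ℚ.* (partitionSum L (suc m) c₁ ℚ.+ partitionSum L (suc m) c₂)
    partitionSum-step L m l c₁ c₂ w l≤L step = begin
      partitionSum L (2 + m) l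
        ≡⟨ partitionSum-head L (suc m) l l≤L ⟩
      sumL (λ xs → contrib l (l ∷ xs)) (allLists (suc m) L)
        ≡⟨ sumL-allLists-cong m L {λ xs → contrib l (l ∷ xs)} {λ xs → w ℚ.* (contrib c₁ xs ℚ.+ contrib c₂ xs)} step ⟩
      sumL (λ xs → w ℚ.* (contrib c₁ xs ℚ.+ contrib c₂ xs)) (allLists (suc m) L)
        ≡⟨ sumL-*ˡ w (λ xs → contrib c₁ xs ℚ.+ contrib c₂ xs) (allLists (suc m) L) ⟩
      w ℚ.* sumL (λ xs → contrib c₁ xs ℚ.+ contrib c₂ xs) (allLists (suc m) L)
        ≡⟨ cong (w ℚ.*_) (sumL-+ (contrib c₁) (contrib c₂) (allLists (suc m) L)) ⟩
      w ℚ.* (partitionSum L (suc m) c₁ ℚ.+ partitionSum L (suc m) c₂) ∎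
      where open ≡-Reasoning

    partitionSum-recurrences : ∀ L → Recurrences L (partitionSum L)
    partitionSum-recurrences L = record
      { one-a  = λ a≤L → begin
          partitionSum L 1 a ≡⟨ partitionSum-one L a a≤L ⟩
          contrib a (a ∷ []) ≡⟨ contrib-single a adm-a (cong (_∨ does (a ℕ.≟ b)) (dec-true (a ℕ.≟ a) refl)) ⟩
          wt (a ∷ [])        ≡⟨ wt-cons-a a [] a≡a a≢b ⟩
          weightA a ℚ.* 1ℚ   ≡⟨ ℚP.*-identityʳ _ ⟩
          weightA a          ∎
      ; one-b  = λ b≤L → begin
          partitionSum L 1 b ≡⟨ partitionSum-one L b b≤L ⟩
          contrib b (b ∷ []) ≡⟨ contrib-single b adm-b (trans (cong (does (b ℕ.≟ a) ∨_) (dec-true (b ℕ.≟ b) refl))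
                                                              (BoolP.∨-zeroʳ _)) ⟩
          wt (b ∷ [])        ≡⟨ wt-cons-b b [] b≢a b≡b ⟩
          weightB b ℚ.* 1ℚ   ≡⟨ ℚP.*-identityʳ _ ⟩
          weightB b          ∎
      ; one-A  = λ h ≤L → trans (partitionSum-one L _ ≤L) (contrib-single-≡0 _ (beyond-b (b<A h)))
      ; one-B  = λ h ≤L → trans (partitionSum-one L _ ≤L) (contrib-single-≡0 _ (beyond-b (b<B h)))
      -- a has no predecessor in the class of b; 0 serves as a dummy one, since no partition has largest part 0.
      ; step-a = λ m a≤L → begin
          partitionSum L (2 + m) a
            ≡⟨ partitionSum-step L m a a 0 (weightA a) a≤L
                 (contrib-step a a 0 (weightA a) adm-a (λ zs → wt-cons-a a zs a≡a a≢b) a≢0 (self-window a) (z≤n , a<k)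
                   (λ y _ a≤y (y≤a , _) → inj₁ (ℕP.≤-antisym y≤a a≤y))) ⟩
          weightA a ℚ.* (partitionSum L (suc m) a ℚ.+ partitionSum L (suc m) 0)
            ≡⟨ cong (λ z → weightA a ℚ.* (partitionSum L (suc m) a ℚ.+ z)) (partitionSum-zero L (suc m)) ⟩
          weightA a ℚ.* (partitionSum L (suc m) a ℚ.+ 0ℚ)
            ≡⟨ cong (weightA a ℚ.*_) (ℚP.+-identityʳ _) ⟩
          weightA a ℚ.* partitionSum L (suc m) a ∎
      ; step-A = λ m h ≤L → partitionSum-step L m (k * suc h + a) (k * suc h + a) (k * h + b) (weightA (k * suc h + a))
                              ≤L (step-A h)
      ; step-B = λ m h ≤L → trans (partitionSum-step L m (k * h + b) (k * h + a) (k * h + b) (weightB (k * h + b)) ≤L (step-B h))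
                                  (cong (weightB (k * h + b) ℚ.*_)
                                        (ℚP.+-comm (partitionSum L (suc m) (k * h + a)) (partitionSum L (suc m) (k * h + b))))
      }
      where
      open ≡-Reasoning
      k>0 : 0 < k
      k>0 = ℕ.>-nonZero⁻¹ k
      self-window : ∀ l → Window l l
      self-window l = ℕP.≤-refl , ℕP.m<m+n l k>0
      a≡a : congB k a b a a ≡ true
      a≡a = dec-true (a % k ℕ.≟ a % k) refl
      b≡b : congB k a b b b ≡ true
      b≡b = dec-true (b % k ℕ.≟ b % k) refl
      a≢b : congB k a b a b ≡ false
      a≢b = dec-false (a % k ℕ.≟ b % k) a%k≢b%k
      b≢a : congB k a b b a ≡ false
      b≢a = dec-false (b % k ℕ.≟ a % k) (λ eq → a%k≢b%k (sym eq))
      adm-a : admissible a ≡ true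
      adm-a = cong (_∨ congB k a b a b) a≡a
      adm-b : admissible b ≡ true
      adm-b = trans (cong (congB k a b b a ∨_) b≡b) (BoolP.∨-zeroʳ _)
      a≢0 : a ≢ 0
      a≢0 a≡0 = ℕP.<-irrefl (sym a≡0) 1≤a
      b<A : ∀ h → b < k * suc h + a
      b<A h = ℕP.≤-<-trans (ℕP.≤-trans b≤k (ℕP.m≤m*n k (suc h))) (ℕP.m<m+n (k * suc h) 1≤a)
      b<B : ∀ h → b < k * suc h + b
      b<B h = ℕP.m<n+m b (ℕP.<-≤-trans k>0 (ℕP.m≤m*n k (suc h)))
      beyond-b : ∀ {l} → b < l → does (l ℕ.≟ a) ∨ does (l ℕ.≟ b) ≡ false
      beyond-b {l} b<l = cong₂ _∨_ (dec-false (l ℕ.≟ a) (λ l≡a → ℕP.<-irrefl (sym l≡a) (ℕP.<-trans a<b b<l)))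
                                   (dec-false (l ℕ.≟ b) (λ l≡b → ℕP.<-irrefl (sym l≡b) b<l))
      step-A : ∀ h y ys → contrib (k * suc h + a) (k * suc h + a ∷ y ∷ ys)
        ≡ weightA (k * suc h + a) ℚ.* (contrib (k * suc h + a) (y ∷ ys) ℚ.+ contrib (k * h + b) (y ∷ ys))
      step-A h = contrib-step l l c (weightA l) (cong (_∨ congB k a b l b) (congB-self (suc h) a))
        (λ zs → wt-cons-a l zs (congB-self (suc h) a) (congB-a-b (suc h)))
        (λ l≡c → ℕP.<-irrefl (sym l≡c) c<l) (self-window l) window-c (predecessors (self-window l) window-c)
        where
        l = k * suc h + a
        c = k * h + b
        c<l : c < l
        c<l = subst (_≤ l) (ℕP.+-suc (k * h) b) (class-≤ h (subst (_≤ k + a) (ℕP.+-comm b 1) (ℕP.+-mono-≤ b≤k 1≤a)))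
        window-c : Window l c
        window-c = ℕP.<⇒≤ c<l , subst (l <_) (sym (next-multiple h b)) (ℕP.+-monoʳ-< (k * suc h) a<b)
      step-B : ∀ h y ys → contrib (k * h + b) (k * h + b ∷ y ∷ ys)
        ≡ weightB (k * h + b) ℚ.* (contrib (k * h + a) (y ∷ ys) ℚ.+ contrib (k * h + b) (y ∷ ys))
      step-B h = contrib-step l c l (weightB l) (trans (cong (congB k a b l a ∨_) (congB-self h b)) (BoolP.∨-zeroʳ _))
        (λ zs → wt-cons-b l zs (congB-b-a h) (congB-self h b))
        (λ c≡l → ℕP.<-irrefl c≡l c<l) window-c (self-window l) (predecessors window-c (self-window l))
        where
        l = k * h + b
        c = k * h + a
        c<l : c < l
        c<l = ℕP.+-monoʳ-< (k * h) a<b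
        window-c : Window l c
        window-c = ℕP.<⇒≤ c<l , subst (l <_) (sym (ℕP.+-assoc (k * h) a k)) (ℕP.+-monoʳ-< (k * h) (ℕP.+-mono-≤ 1≤a b≤k))

lemma2p3 : (k a b : ℕ) {{_ : NonZero k}} → 1 ≤ a → a < b → b ≤ k →
    (μ ν q : ℚ) → q ≢ 1ℚ → q ≢ - 1ℚ →
    ((m : ℕ) → 1 ≤ m → g k a b μ ν q m a ≡ (μ ^ m) ℚ.* (q ^ (m * a))) ×
    ((m h : ℕ) → 1 ≤ m → 1 ≤ h →
      g k a b μ ν q m (k * h + a) ≡
        sumℚ (m + 1) (λ i →
          (μ ^ (m ∸ h ∸ i)) ℚ.* (ν ^ (h + i))
          ℚ.* (q ^ (m * a + k * (h * h) + (b ∸ a) * (h + i)))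
          ℚ.* qbin q k (+ (h + i) ℤ.- + 1) (+ h ℤ.- + 1)
          ℚ.* qbin q k (+ m ℤ.- + h ℤ.- + i) (+ h))) ×
    ((m h : ℕ) → 1 ≤ m →
      g k a b μ ν q m (k * h + b) ≡
        sumℚ (m + 1) (λ i →
          (μ ^ (m ∸ h ∸ i ∸ 1)) ℚ.* (ν ^ (h + i + 1))
          ℚ.* (q ^ (m * a + k * (h * h) + k * h + (b ∸ a) * (h + i + 1)))
          ℚ.* qbin q k (+ (h + i)) (+ h)
          ℚ.* qbin q k (+ m ℤ.- + h ℤ.- + i ℤ.- + 1) (+ h)))
lemma2p3 k a b 1≤a a<b b≤k μ ν q q≢1 q≢-1 = part-a , part-A , part-B
  where
  open Partitions k a b μ ν q
  solution : ∀ L m → ClosedFormsHold L (partitionSum L) m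
  solution L = recurrences⇒closedForms q≢1 q≢-1 (ℕP.<⇒≤ a<b) (partitionSum-recurrences 1≤a a<b b≤k L) a<b b≤k
  count : ∀ m (f : ℕ → ℚ) → sumℚ (suc m) f ≡ sumℚ (m + 1) f
  count m f = cong (λ n → sumℚ n f) (ℕP.+-comm 1 m)
  part-a : (m : ℕ) → 1 ≤ m → g k a b μ ν q m a ≡ closed-a m
  part-a (suc m) _ = trans (g≡partitionSum (suc m) a) (proj₁ (solution a m) ℕP.≤-refl)
  part-A : (m h : ℕ) → 1 ≤ m → 1 ≤ h → g k a b μ ν q m (k * h + a) ≡ sumℚ (m + 1) (termA m h)
  part-A (suc m) (suc h) _ _ = trans (g≡partitionSum (suc m) (k * suc h + a))
    (trans (proj₁ (proj₂ (solution (k * suc h + a) m)) h ℕP.≤-refl) (count (suc m) (termA (suc m) (suc h))))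
  part-B : (m h : ℕ) → 1 ≤ m → g k a b μ ν q m (k * h + b) ≡ sumℚ (m + 1) (termB m h)
  part-B (suc m) h _ = trans (g≡partitionSum (suc m) (k * h + b))
    (trans (proj₂ (proj₂ (solution (k * h + b) m)) h ℕP.≤-refl) (count (suc m) (termB (suc m) h)))
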